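{- Let $n\ge 2$, $l_1,\dots,l_n,l_\infty\ge 0$, and $x\in X(l_1,\dots,l_n,l_\infty)$. Let $\sigma$ be a permutation of $\{1,\dots,n\}$ with $l_{\sigma(k)}=l_k$ for all $k$, and let $x'$ be the diagram obtained from $x$ by replacing each label $z_k$ with $z_{\sigma(k)}$ (keeping points and arcs otherwise unchanged). Then there exists $g\in J_n$ with $gx=x'$; that is, points of equal valence can be rearranged into an arbitrary order without changing anything else in the diagram.
   Context: An arc diagram of type $(l_1,\dots,l_n,l_\infty)$ consists of a circle (the boundary of a closed disc) carrying $n+1$ distinct marked points labelled $z_\infty,z_1,\dots,z_n$ (the labels $z_1,\dots,z_n$ may appear in any order), together with finitely many arcs inside the disc, pairwise non-intersecting except at endpoints, each joining two distinct marked points (several arcs may join the same pair), such that $z_k$ is an endpoint of exactly $l_k$ arcs. Diagrams are considered up to continuous deformation; $X(l_1,\dots,l_n,l_\infty)$ is the set of all of them. Going clockwise from $z_\infty$, the other marked points occupy positions $1,\dots,n$. The cactus group $J_n$ has generators $s_{p,q}$ ($1\le p<q\le n$) and relations $s_{p,q}^2=e$; $s_{p,q}s_{p',q'}=s_{p',q'}s_{p,q}$ if $[p,q]\cap[p',q']=\emptyset$; $s_{p,q}s_{p',q'}s_{p,q}=s_{p+q-q',p+q-p'}$ if $p\le p'<q'\le q$. It acts on $X(l_1,\dots,l_n,l_\infty)$ as follows: for $s_{p,q}$, take a chord $c$ separating the points in positions $p,\dots,q$ from the other marked points (arcs deformed to cross $c$ at most once), reflect the part of the diagram on the side of $c$ not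 containing $z_\infty$ across the perpendicular bisector of $c$ (reversing the order of the points in positions $p,\dots,q$ and of the crossing points on $c$), and rejoin the arc pieces across $c$. Products act right to left. -}

module Defs where

open import Data.Nat using (ℕ; zero; suc; _+_; _∸_; _≤_; _<_; _<?_; _≤ᵇ_; _≡ᵇ_)
open import Data.Bool using (Bool; true; false; _∧_; if_then_else_)
open import Data.Fin using (Fin; zero; suc; toℕ; fromℕ<)
open import Data.Fin.Permutation using (Permutation′; _⟨$⟩ʳ_)
open import Data.List using (List; []; _∷_; _++_; map; reverse; upTo; concatMap; replicate; zip; tabulate; length)
open import Data.Nat.ListAction using (sum)
open import Data.Product using (_×_; _,_; proj₁; proj₂)
open import Data.Sum using (_⊎_)
open import Relation.Nullary using (yes; no)
open import Relation.Binary.PropositionalEquality using (_≡_)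
open import Function.Definitions using (Injective)

-- Positions on the circle: Pos n = Fin (suc n); position 0 is the point
-- carrying z∞, positions 1..n are the others, clockwise from z∞.
-- Labels: also Fin (suc n); label 0 = z∞, label (suc k) = z_{k+1}.
-- An arc diagram up to continuous deformation is determined by
--   * lab  : which label sits at which position,
--   * mult : number of arcs joining the points at two positions,
-- subject to: no loops, symmetry, non-crossing, and valences.

Pos : ℕ → Set
Pos n = Fin (suc n)

record Raw (n : ℕ) : Set where
  constructor raw⟨_,_⟩
  field
    lab  : Pos n → Pos n
    mult : Pos n → Pos n → ℕ
open Raw public

deg : ∀ {n} → Raw n → Pos n → ℕ
deg {n} x a = sum (tabulate {n = suc n} (λ b → mult x a b))

lval : ∀ {n} → (Fin n → ℕ) → ℕ → Pos n → ℕ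
lval l l∞ zero    = l∞
lval l l∞ (suc k) = l k

record Diagram (n : ℕ) (l : Fin n → ℕ) (l∞ : ℕ) : Set where
  field
    raw       : Raw n
    lab-∞     : lab raw zero ≡ zero
    lab-inj   : Injective _≡_ _≡_ (lab raw)
    no-loop   : ∀ a → mult raw a a ≡ 0
    symm      : ∀ a b → mult raw a b ≡ mult raw b a
    noncross  : ∀ a b c d → toℕ a < toℕ b → toℕ b < toℕ c → toℕ c < toℕ d →
                mult raw a c ≡ 0 ⊎ mult raw b d ≡ 0
    valence   : ∀ a → deg raw a ≡ lval l l∞ (lab raw a)
open Diagram public

_≈R_ : ∀ {n} → Raw n → Raw n → Set
x ≈R y = (∀ a → lab x a ≡ lab y a) × (∀ a b → mult x a b ≡ mult y a b)

liftσ : ∀ {n} → Permutation′ n → Pos n → Pos n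
liftσ σ zero    = zero
liftσ σ (suc k) = suc (σ ⟨$⟩ʳ k)

relabel : ∀ {n} → Permutation′ n → Raw n → Raw n
relabel σ x = raw⟨ (λ a → liftσ σ (lab x a)) , mult x ⟩

record Gen (n : ℕ) : Set where
  constructor s[_,_]
  field
    p    : ℕ
    q    : ℕ
    {1≤p} : 1 ≤ p
    {p<q} : p < q
    {q≤n} : q ≤ n

-- natural number to position (only used on values ≤ n)
clamp : (n : ℕ) → ℕ → Fin (suc n)
clamp n k with k <? suc n
... | yes h = fromℕ< h
... | no _  = zero

inBlock : ℕ → ℕ → ℕ → Bool
inBlock p q a = (p ≤ᵇ a) ∧ (a ≤ᵇ q)

reflℕ : ℕ → ℕ → ℕ → ℕ
reflℕ p q a = if inBlock p q a then p + q ∸ a else a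

count : List (ℕ × ℕ) → ℕ → ℕ → ℕ
count []             a b = 0
count ((x , y) ∷ xs) a b =
  if (x ≡ᵇ a) ∧ (y ≡ᵇ b) then suc (count xs a b) else count xs a b

module Action {n : ℕ} (p q : ℕ) (x : Raw n) where
  multℕ : ℕ → ℕ → ℕ
  multℕ a b = mult x (clamp n a) (clamp n b)

  -- outer positions in the order met along the chord c, starting
  -- next to the gap between positions p-1 and p: p-1,...,0,n,...,q+1
  outerOrder : List ℕ
  outerOrder = reverse (upTo p) ++ map (λ k → n ∸ k) (upTo (n ∸ q))

  innerOrder : List ℕ
  innerOrder = map (p +_) (upTo (suc (q ∸ p)))

  -- arcs crossing c, as (outer, inner) pairs, in order along c
  crossing : List (ℕ × ℕ)
  crossing = concatMap (λ i → concatMap (λ o → replicate (multℕ o i) (o , i)) outerOrder) innerOrder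

  -- rejoined crossing arcs after reflecting the inner part
  newCrossing : List (ℕ × ℕ)
  newCrossing = zip (map proj₁ crossing) (reverse (map (λ c → reflℕ p q (proj₂ c)) crossing))

  newMult : Pos n → Pos n → ℕ
  newMult a b with inBlock p q (toℕ a) | inBlock p q (toℕ b)
  ... | true  | true  = multℕ (reflℕ p q (toℕ a)) (reflℕ p q (toℕ b))
  ... | false | false = mult x a b
  ... | false | true  = count newCrossing (toℕ a) (toℕ b)
  ... | true  | false = count newCrossing (toℕ b) (toℕ a)

  newLab : Pos n → Pos n
  newLab a = lab x (clamp n (reflℕ p q (toℕ a)))

  result : Raw n
  result = raw⟨ newLab , newMult ⟩

act : ∀ {n} → Gen n → Raw n → Raw n
act s[ p , q ] x = Action.result p q x

-- a word g₁ g₂ … g_k acts right to left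
actW : ∀ {n} → List (Gen n) → Raw n → Raw n
actW []      x = x
actW (g ∷ w) x = act g (actW w x)

-- Read the arcs of a diagram as a symmetric, loopless, non-crossing multiplicity matrix on the
-- positions 0, …, n.  The adjacent generator s_{k,k+1} cuts the arcs at k and k+1 along a chord
-- and rejoins them in reverse order.  Arcs do not cross, so along the chord all arcs at k precede
-- all arcs at k+1; after rejoining, k therefore receives as many arcs as k+1 had and vice versa.
-- Consequently s_{k,k+1} is an involution on arc systems that moves the degree of k to k+1 and
-- keeps the degrees beyond k+1, and when k and k+1 have equal degree it merely exchanges their
-- labels.  Conjugating by s_{i,i+1} turns an exchange of the labels at i+1 and j into one at i
-- and j, so the labels of any two positions of equal degree can be exchanged.  As σ preserves
-- valences, selection sort by such exchanges reaches the relabelled diagram.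

{-# OPTIONS --safe #-}
module Submission where

open import Defs
open import Data.Bool using (Bool; true; false; if_then_else_; T)
open import Data.Bool.Properties using (T-≡; if-eta; ∧-zeroʳ)
open import Data.Empty using (⊥; ⊥-elim)
open import Data.Fin using (Fin; zero; suc; toℕ; punchOut)
import Data.Fin.Properties as Fin
open import Data.Fin.Permutation using (Permutation′; _⟨$⟩ʳ_; _⟨$⟩ˡ_; inverseˡ)
open import Data.List using (List; []; _∷_; _++_; map; reverse; upTo; applyUpTo; concatMap; replicate; zip; tabulate)
import Data.List.Properties as List
open import Data.List.Membership.Propositional using (_∈_; _∉_)
import Data.List.Membership.Propositional.Properties as ∈
open import Data.List.Relation.Unary.All as All using (All; []; _∷_)
import Data.List.Relation.Unary.All.Properties as Allₚ
open import Data.List.Relation.Unary.AllPairs as AllPairs using (AllPairs; []; _∷_)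
import Data.List.Relation.Unary.AllPairs.Properties as AllPairsₚ
open import Data.List.Relation.Unary.Any using (here; there)
open import Data.List.Relation.Unary.Unique.Propositional using (Unique)
open import Data.List.Relation.Unary.Unique.Propositional.Properties using (Unique[x∷xs]⇒x∉xs)
open import Data.Nat
open import Data.Nat.ListAction using (sum)
open import Data.Nat.Properties
open import Data.Nat.Solver using (module +-*-Solver)
open import Data.Product using (_×_; _,_; proj₁; proj₂; ∃-syntax; Σ)
open import Data.Sum as Sum using (_⊎_; inj₁; inj₂; [_,_]′)
open import Data.Unit using (⊤; tt)
open import Function.Base using (_∘_)
open import Function.Bundles using (Equivalence)
open import Function.Definitions using (Injective)
open import Relation.Nullary using (Dec; yes; no)
open import Relation.Binary.PropositionalEquality
open +-*-Solver using (solve; _:+_; _:=_; con)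

T⇒≡true : ∀ {b} → T b → b ≡ true
T⇒≡true = Equivalence.to T-≡

≡ᵇ-true⇒≡ : ∀ {a b} → (a ≡ᵇ b) ≡ true → a ≡ b
≡ᵇ-true⇒≡ {a} {b} e = ≡ᵇ⇒≡ a b (subst T (sym e) tt)

≡ᵇ-refl : ∀ a → (a ≡ᵇ a) ≡ true
≡ᵇ-refl a = T⇒≡true (≡⇒≡ᵇ a a refl)

≢⇒≡ᵇ-false : ∀ {a b} → a ≢ b → (a ≡ᵇ b) ≡ false
≢⇒≡ᵇ-false {a} {b} a≢b with a ≡ᵇ b in eq
... | true  = ⊥-elim (a≢b (≡ᵇ-true⇒≡ eq))
... | false = refl

if-≡ᵇ-refl : ∀ e {A : Set} {x y : A} → (if e ≡ᵇ e then x else y) ≡ x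
if-≡ᵇ-refl e rewrite ≡ᵇ-refl e = refl

if-≡ᵇ-≢ : ∀ {e o} {A : Set} {x y : A} → e ≢ o → (if e ≡ᵇ o then x else y) ≡ y
if-≡ᵇ-≢ e≢o rewrite ≢⇒≡ᵇ-false e≢o = refl

≤⇒≤ᵇ-true : ∀ {a b} → a ≤ b → (a ≤ᵇ b) ≡ true
≤⇒≤ᵇ-true a≤b = T⇒≡true (≤⇒≤ᵇ a≤b)

≤ᵇ-true⇒≤ : ∀ {a b} → (a ≤ᵇ b) ≡ true → a ≤ b
≤ᵇ-true⇒≤ {a} {b} e = ≤ᵇ⇒≤ a b (subst T (sym e) tt)

>⇒≤ᵇ-false : ∀ {a b} → b < a → (a ≤ᵇ b) ≡ false
>⇒≤ᵇ-false {a} {b} b<a with a ≤ᵇ b in eq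
... | true  = ⊥-elim (<⇒≱ b<a (≤ᵇ-true⇒≤ eq))
... | false = refl

≤ᵇ-false⇒> : ∀ {a b} → (a ≤ᵇ b) ≡ false → b < a
≤ᵇ-false⇒> e = ≰⇒> (λ a≤b → subst T e (≤⇒≤ᵇ a≤b))

<⇒<ᵇ-true : ∀ {a b} → a < b → (a <ᵇ b) ≡ true
<⇒<ᵇ-true a<b = T⇒≡true (<⇒<ᵇ a<b)

≥⇒<ᵇ-false : ∀ {a b} → b ≤ a → (a <ᵇ b) ≡ false
≥⇒<ᵇ-false {a} {b} b≤a with a <ᵇ b in eq
... | true  = ⊥-elim (<⇒≱ (<ᵇ⇒< a b (subst T (sym eq) tt)) b≤a)
... | false = refl

m⊓n+o⊓[n∸m]≡n : ∀ m n o → n ≤ m + o → m ⊓ n + o ⊓ (n ∸ m) ≡ n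
m⊓n+o⊓[n∸m]≡n zero    n       o n≤o       = m≥n⇒m⊓n≡n n≤o
m⊓n+o⊓[n∸m]≡n (suc m) zero    o _         = ⊓-zeroʳ o
m⊓n+o⊓[n∸m]≡n (suc m) (suc n) o (s≤s n≤m+o) = cong suc (m⊓n+o⊓[n∸m]≡n m n o n≤m+o)

[m∸n]+[o∸[n∸m]]≡m+o∸n : ∀ m n o → (m ∸ n) + (o ∸ (n ∸ m)) ≡ m + o ∸ n
[m∸n]+[o∸[n∸m]]≡m+o∸n zero    n       o rewrite 0∸n≡0 n = refl
[m∸n]+[o∸[n∸m]]≡m+o∸n (suc m) zero    o = refl
[m∸n]+[o∸[n∸m]]≡m+o∸n (suc m) (suc n) o = [m∸n]+[o∸[n∸m]]≡m+o∸n m n o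

m⊓n+[m∸n]≡m : ∀ m n → m ⊓ n + (m ∸ n) ≡ m
m⊓n+[m∸n]≡m m n = trans (cong (_+ (m ∸ n)) (⊓-comm m n)) (m⊓n+n∸m≡n n m)

sumMap : {A : Set} → (A → ℕ) → List A → ℕ
sumMap f []       = 0
sumMap f (x ∷ xs) = f x + sumMap f xs

sumMap-cong : ∀ {A : Set} {f g : A → ℕ} xs → (∀ {x} → x ∈ xs → f x ≡ g x) → sumMap f xs ≡ sumMap g xs
sumMap-cong []       f≗g = refl
sumMap-cong (x ∷ xs) f≗g = cong₂ _+_ (f≗g (here refl)) (sumMap-cong xs (f≗g ∘ there))

sumMap-++ : ∀ {A : Set} (f : A → ℕ) xs ys → sumMap f (xs ++ ys) ≡ sumMap f xs + sumMap f ys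
sumMap-++ f []       ys = refl
sumMap-++ f (x ∷ xs) ys = trans (cong (f x +_) (sumMap-++ f xs ys)) (sym (+-assoc (f x) _ _))

sumMap-+ : ∀ {A : Set} (f g : A → ℕ) xs → sumMap (λ x → f x + g x) xs ≡ sumMap f xs + sumMap g xs
sumMap-+ f g []       = refl
sumMap-+ f g (x ∷ xs) rewrite sumMap-+ f g xs =
  solve 4 (λ a b c d → (a :+ b) :+ (c :+ d) := (a :+ c) :+ (b :+ d)) refl (f x) (g x) (sumMap f xs) (sumMap g xs)

copies : (ℕ → ℕ) → List ℕ → List ℕ
copies C = concatMap (λ e → replicate (C e) e)

-- Deal the cards  copies C E  in order, the first r onto one pile and the next s onto
-- another; share₁ and share₂ count the copies of o landing on the first and second pile.
share₁ share₂ : (ℕ → ℕ) → ℕ → ℕ → List ℕ → ℕ → ℕ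
share₁ C r s []      o = 0
share₁ C r s (e ∷ E) o = (if e ≡ᵇ o then r ⊓ C e else 0) + share₁ C (r ∸ C e) (s ∸ (C e ∸ r)) E o
share₂ C r s []      o = 0
share₂ C r s (e ∷ E) o = (if e ≡ᵇ o then s ⊓ (C e ∸ r) else 0) + share₂ C (r ∸ C e) (s ∸ (C e ∸ r)) E o

module CountZip (u v : ℕ) (u≢v : u ≢ v) where

  count-zip-replicate₁ : ∀ c e L r s o →
    count (zip (replicate c e ++ L) (replicate r u ++ replicate s v)) o u ≡
    (if e ≡ᵇ o then r ⊓ c else 0) + count (zip L (replicate (r ∸ c) u ++ replicate (s ∸ (c ∸ r)) v)) o u
  count-zip-replicate₁ zero    e L zero    s       o = sym (cong (_+ _) (if-eta (e ≡ᵇ o)))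
  count-zip-replicate₁ zero    e L (suc r) s       o = sym (cong (_+ _) (if-eta (e ≡ᵇ o)))
  count-zip-replicate₁ (suc c) e L (suc r) s       o with e ≡ᵇ o in e≟o
  ... | true  rewrite ≡ᵇ-refl u | count-zip-replicate₁ c e L r s o | e≟o = refl
  ... | false rewrite count-zip-replicate₁ c e L r s o | e≟o = refl
  count-zip-replicate₁ (suc c) e []      zero zero o rewrite if-eta (e ≡ᵇ o) {0} = refl
  count-zip-replicate₁ (suc c) e (_ ∷ _) zero zero o rewrite if-eta (e ≡ᵇ o) {0} = refl
  count-zip-replicate₁ (suc c) e L zero (suc s) o
    rewrite ≢⇒≡ᵇ-false (u≢v ∘ sym) | ∧-zeroʳ (e ≡ᵇ o) | count-zip-replicate₁ c e L zero s o | 0∸n≡0 c = refl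

  count-zip-replicate₂ : ∀ c e L r s o →
    count (zip (replicate c e ++ L) (replicate r u ++ replicate s v)) o v ≡
    (if e ≡ᵇ o then s ⊓ (c ∸ r) else 0) + count (zip L (replicate (r ∸ c) u ++ replicate (s ∸ (c ∸ r)) v)) o v
  count-zip-replicate₂ zero    e L zero    zero    o = sym (cong (_+ _) (if-eta (e ≡ᵇ o)))
  count-zip-replicate₂ zero    e L zero    (suc s) o = sym (cong (_+ _) (if-eta (e ≡ᵇ o)))
  count-zip-replicate₂ zero    e L (suc r) zero    o = sym (cong (_+ _) (if-eta (e ≡ᵇ o)))
  count-zip-replicate₂ zero    e L (suc r) (suc s) o = sym (cong (_+ _) (if-eta (e ≡ᵇ o)))
  count-zip-replicate₂ (suc c) e L (suc r) s       o
    rewrite ≢⇒≡ᵇ-false u≢v | ∧-zeroʳ (e ≡ᵇ o) | count-zip-replicate₂ c e L r s o = refl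
  count-zip-replicate₂ (suc c) e []      zero zero o rewrite if-eta (e ≡ᵇ o) {0} = refl
  count-zip-replicate₂ (suc c) e (_ ∷ _) zero zero o rewrite if-eta (e ≡ᵇ o) {0} = refl
  count-zip-replicate₂ (suc c) e L zero (suc s) o with e ≡ᵇ o in e≟o
  ... | true  rewrite ≡ᵇ-refl v | count-zip-replicate₂ c e L zero s o | e≟o | 0∸n≡0 c = refl
  ... | false rewrite count-zip-replicate₂ c e L zero s o | e≟o | 0∸n≡0 c = refl

  count-zip-copies₁ : ∀ C E r s o →
    count (zip (copies C E) (replicate r u ++ replicate s v)) o u ≡ share₁ C r s E o
  count-zip-copies₁ C []      r s o = refl
  count-zip-copies₁ C (e ∷ E) r s o =
    trans (count-zip-replicate₁ (C e) e _ r s o) (cong (_ +_) (count-zip-copies₁ C E _ _ o))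

  count-zip-copies₂ : ∀ C E r s o →
    count (zip (copies C E) (replicate r u ++ replicate s v)) o v ≡ share₂ C r s E o
  count-zip-copies₂ C []      r s o = refl
  count-zip-copies₂ C (e ∷ E) r s o =
    trans (count-zip-replicate₂ (C e) e _ r s o) (cong (_ +_) (count-zip-copies₂ C E _ _ o))

share₁-∉ : ∀ C r s E o → o ∉ E → share₁ C r s E o ≡ 0
share₁-∉ C r s []      o o∉E = refl
share₁-∉ C r s (e ∷ E) o o∉E
  rewrite if-≡ᵇ-≢ {e} {o} {x = r ⊓ C e} {y = 0} (λ e≡o → o∉E (here (sym e≡o))) =
  share₁-∉ C (r ∸ C e) (s ∸ (C e ∸ r)) E o (o∉E ∘ there)

share₂-∉ : ∀ C r s E o → o ∉ E → share₂ C r s E o ≡ 0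
share₂-∉ C r s []      o o∉E = refl
share₂-∉ C r s (e ∷ E) o o∉E
  rewrite if-≡ᵇ-≢ {e} {o} {x = s ⊓ (C e ∸ r)} {y = 0} (λ e≡o → o∉E (here (sym e≡o))) =
  share₂-∉ C (r ∸ C e) (s ∸ (C e ∸ r)) E o (o∉E ∘ there)

share₁-zero : ∀ C s E o → share₁ C 0 s E o ≡ 0
share₁-zero C s []      o = refl
share₁-zero C s (e ∷ E) o rewrite if-eta (e ≡ᵇ o) {0} | 0∸n≡0 (C e) = share₁-zero C (s ∸ C e) E o

share₁-cong : ∀ C C′ r s E o → (∀ {e} → e ∈ E → C e ≡ C′ e) → share₁ C r s E o ≡ share₁ C′ r s E o
share₁-cong C C′ r s []      o C≗C′ = refl
share₁-cong C C′ r s (e ∷ E) o C≗C′ rewrite C≗C′ (here refl) =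
  cong (_ +_) (share₁-cong C C′ (r ∸ C′ e) (s ∸ (C′ e ∸ r)) E o (C≗C′ ∘ there))

share₂-cong : ∀ C C′ r s E o → (∀ {e} → e ∈ E → C e ≡ C′ e) → share₂ C r s E o ≡ share₂ C′ r s E o
share₂-cong C C′ r s []      o C≗C′ = refl
share₂-cong C C′ r s (e ∷ E) o C≗C′ rewrite C≗C′ (here refl) =
  cong (_ +_) (share₂-cong C C′ (r ∸ C′ e) (s ∸ (C′ e ∸ r)) E o (C≗C′ ∘ there))

share₁-nonzero⇒∈ : ∀ C r s E o → share₁ C r s E o ≢ 0 → o ∈ E
share₁-nonzero⇒∈ C r s []      o ≢0 = ⊥-elim (≢0 refl)
share₁-nonzero⇒∈ C r s (e ∷ E) o ≢0 with e ≡ᵇ o in e≟o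
... | true  = here (sym (≡ᵇ-true⇒≡ e≟o))
... | false = there (share₁-nonzero⇒∈ C (r ∸ C e) (s ∸ (C e ∸ r)) E o ≢0)

share₂-nonzero⇒∈ : ∀ C r s E o → share₂ C r s E o ≢ 0 → o ∈ E
share₂-nonzero⇒∈ C r s []      o ≢0 = ⊥-elim (≢0 refl)
share₂-nonzero⇒∈ C r s (e ∷ E) o ≢0 with e ≡ᵇ o in e≟o
... | true  = here (sym (≡ᵇ-true⇒≡ e≟o))
... | false = there (share₂-nonzero⇒∈ C (r ∸ C e) (s ∸ (C e ∸ r)) E o ≢0)

unique-head-≢ : ∀ {A : Set} {e o : A} {E} → Unique (e ∷ E) → o ∈ E → e ≢ o
unique-head-≢ uniq o∈E refl = Unique[x∷xs]⇒x∉xs uniq o∈E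

piles-remaining : ∀ (C : ℕ → ℕ) r s e E → r + s ≡ sumMap C (e ∷ E) → (r ∸ C e) + (s ∸ (C e ∸ r)) ≡ sumMap C E
piles-remaining C r s e E r+s≡ =
  trans ([m∸n]+[o∸[n∸m]]≡m+o∸n r (C e) s) (trans (cong (_∸ C e) r+s≡) (m+n∸m≡n (C e) _))

share₁+share₂ : ∀ C r s E o → Unique E → o ∈ E → r + s ≡ sumMap C E →
                share₁ C r s E o + share₂ C r s E o ≡ C o
share₁+share₂ C r s (e ∷ E) .e uniq (here refl) r+s≡
  rewrite if-≡ᵇ-refl e {x = r ⊓ C e} {y = 0} | if-≡ᵇ-refl e {x = s ⊓ (C e ∸ r)} {y = 0}
        | share₁-∉ C (r ∸ C e) (s ∸ (C e ∸ r)) E e (Unique[x∷xs]⇒x∉xs uniq)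
        | share₂-∉ C (r ∸ C e) (s ∸ (C e ∸ r)) E e (Unique[x∷xs]⇒x∉xs uniq)
        | +-identityʳ (r ⊓ C e) | +-identityʳ (s ⊓ (C e ∸ r))
  = m⊓n+o⊓[n∸m]≡n r (C e) s (subst (C e ≤_) (sym r+s≡) (m≤m+n (C e) _))
share₁+share₂ C r s (e ∷ E) o uniq@(_ ∷ uniq′) (there o∈E) r+s≡
  rewrite if-≡ᵇ-≢ {e} {o} {x = r ⊓ C e} {y = 0} (unique-head-≢ uniq o∈E)
        | if-≡ᵇ-≢ {e} {o} {x = s ⊓ (C e ∸ r)} {y = 0} (unique-head-≢ uniq o∈E)
  = share₁+share₂ C (r ∸ C e) (s ∸ (C e ∸ r)) E o uniq′ o∈E (piles-remaining C r s e E r+s≡)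

sumMap-share₁ : ∀ C r s E → Unique E → r + s ≡ sumMap C E → sumMap (share₁ C r s E) E ≡ r
sumMap-share₁ C zero    s [] uniq r+s≡ = refl
sumMap-share₁ C (suc r) s [] uniq ()
sumMap-share₁ C r s (e ∷ E) uniq@(_ ∷ uniq′) r+s≡ = begin
    (if e ≡ᵇ e then r ⊓ C e else 0) + share₁ C r′ s′ E e + sumMap (share₁ C r s (e ∷ E)) E
  ≡⟨ cong₂ _+_ (cong₂ _+_ (if-≡ᵇ-refl e) (share₁-∉ C r′ s′ E e (Unique[x∷xs]⇒x∉xs uniq)))
               (sumMap-cong E (λ {o} o∈E → cong (_+ share₁ C r′ s′ E o) (if-≡ᵇ-≢ (unique-head-≢ uniq o∈E)))) ⟩
    r ⊓ C e + 0 + sumMap (share₁ C r′ s′ E) E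
  ≡⟨ cong₂ _+_ (+-identityʳ (r ⊓ C e)) (sumMap-share₁ C r′ s′ E uniq′ (piles-remaining C r s e E r+s≡)) ⟩
    r ⊓ C e + r′
  ≡⟨ m⊓n+[m∸n]≡m r (C e) ⟩
    r
  ∎
  where
  open ≡-Reasoning
  r′ = r ∸ C e
  s′ = s ∸ (C e ∸ r)

sumMap-share₂ : ∀ C r s E → Unique E → r + s ≡ sumMap C E → sumMap (share₂ C r s E) E ≡ s
sumMap-share₂ C zero    zero    [] uniq r+s≡ = refl
sumMap-share₂ C zero    (suc s) [] uniq ()
sumMap-share₂ C (suc r) s       [] uniq ()
sumMap-share₂ C r s (e ∷ E) uniq@(_ ∷ uniq′) r+s≡ = begin
    (if e ≡ᵇ e then s ⊓ (C e ∸ r) else 0) + share₂ C r′ s′ E e + sumMap (share₂ C r s (e ∷ E)) E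
  ≡⟨ cong₂ _+_ (cong₂ _+_ (if-≡ᵇ-refl e) (share₂-∉ C r′ s′ E e (Unique[x∷xs]⇒x∉xs uniq)))
               (sumMap-cong E (λ {o} o∈E → cong (_+ share₂ C r′ s′ E o) (if-≡ᵇ-≢ (unique-head-≢ uniq o∈E)))) ⟩
    s ⊓ (C e ∸ r) + 0 + sumMap (share₂ C r′ s′ E) E
  ≡⟨ cong₂ _+_ (+-identityʳ (s ⊓ (C e ∸ r))) (sumMap-share₂ C r′ s′ E uniq′ (piles-remaining C r s e E r+s≡)) ⟩
    s ⊓ (C e ∸ r) + s′
  ≡⟨ m⊓n+[m∸n]≡m s (C e ∸ r) ⟩
    s
  ∎
  where
  open ≡-Reasoning
  r′ = r ∸ C e
  s′ = s ∸ (C e ∸ r)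

Separated : (ℕ → ℕ) → (ℕ → ℕ) → List ℕ → Set
Separated A B []      = ⊤
Separated A B (e ∷ E) = (B e ≡ 0 × Separated A B E) ⊎ All (λ x → A x ≡ 0) E

replicate-+ : ∀ {A : Set} a b (x : A) → replicate (a + b) x ≡ replicate a x ++ replicate b x
replicate-+ zero    b x = refl
replicate-+ (suc a) b x = cong (x ∷_) (replicate-+ a b x)

copies-zero : ∀ (A : ℕ → ℕ) E → All (λ x → A x ≡ 0) E → copies A E ≡ []
copies-zero A []      []            = refl
copies-zero A (e ∷ E) (Ae≡0 ∷ A≡0) rewrite Ae≡0 = copies-zero A E A≡0

copies-+-zeroˡ : ∀ (A B : ℕ → ℕ) E → All (λ x → A x ≡ 0) E → copies (λ e → A e + B e) E ≡ copies B E
copies-+-zeroˡ A B []      []            = refl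
copies-+-zeroˡ A B (e ∷ E) (Ae≡0 ∷ A≡0) rewrite Ae≡0 = cong (replicate (B e) e ++_) (copies-+-zeroˡ A B E A≡0)

copies-++-separated : ∀ (A B : ℕ → ℕ) E → Separated A B E → copies A E ++ copies B E ≡ copies (λ e → A e + B e) E
copies-++-separated A B []      _ = refl
copies-++-separated A B (e ∷ E) (inj₁ (Be≡0 , sep)) rewrite Be≡0 | +-identityʳ (A e) =
  trans (List.++-assoc (replicate (A e) e) _ _) (cong (replicate (A e) e ++_) (copies-++-separated A B E sep))
copies-++-separated A B (e ∷ E) (inj₂ A≡0) = begin
    (replicate (A e) e ++ copies A E) ++ replicate (B e) e ++ copies B E
  ≡⟨ cong (λ t → (replicate (A e) e ++ t) ++ replicate (B e) e ++ copies B E) (copies-zero A E A≡0) ⟩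
    (replicate (A e) e ++ []) ++ replicate (B e) e ++ copies B E
  ≡⟨ cong (_++ replicate (B e) e ++ copies B E) (List.++-identityʳ (replicate (A e) e)) ⟩
    replicate (A e) e ++ replicate (B e) e ++ copies B E
  ≡⟨ sym (List.++-assoc (replicate (A e) e) _ _) ⟩
    (replicate (A e) e ++ replicate (B e) e) ++ copies B E
  ≡⟨ cong₂ _++_ (sym (replicate-+ (A e) (B e) e)) (sym (copies-+-zeroˡ A B E A≡0)) ⟩
    replicate (A e + B e) e ++ copies (λ e → A e + B e) E
  ∎
  where open ≡-Reasoning

sumMap-zero : ∀ {X : Set} (A : X → ℕ) E → All (λ x → A x ≡ 0) E → sumMap A E ≡ 0
sumMap-zero A []      []            = refl
sumMap-zero A (e ∷ E) (Ae≡0 ∷ A≡0) = cong₂ _+_ Ae≡0 (sumMap-zero A E A≡0)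

share₁-separated : ∀ (A B : ℕ → ℕ) E o → Unique E → Separated A B E → o ∈ E →
                   share₁ (λ e → A e + B e) (sumMap A E) (sumMap B E) E o ≡ A o
share₁-separated A B (e ∷ E) o uniq (inj₁ (Be≡0 , sep)) o∈E = step o∈E
  where
  C = λ e → A e + B e
  r′ = (A e + sumMap A E) ∸ C e
  s′ = (B e + sumMap B E) ∸ (C e ∸ (A e + sumMap A E))
  Ce≡Ae : C e ≡ A e
  Ce≡Ae = trans (cong (A e +_) Be≡0) (+-identityʳ (A e))
  rest₁ : (A e + sumMap A E) ∸ C e ≡ sumMap A E
  rest₁ rewrite Ce≡Ae = m+n∸m≡n (A e) _
  rest₂ : (B e + sumMap B E) ∸ (C e ∸ (A e + sumMap A E)) ≡ sumMap B E
  rest₂ rewrite Ce≡Ae | Be≡0 | m≤n⇒m∸n≡0 (m≤m+n (A e) (sumMap A E)) = refl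
  step : o ∈ e ∷ E → share₁ C (A e + sumMap A E) (B e + sumMap B E) (e ∷ E) o ≡ A o
  step (here refl) = begin
      (if e ≡ᵇ e then (A e + sumMap A E) ⊓ C e else 0) + share₁ C r′ s′ E e
    ≡⟨ cong₂ _+_ (if-≡ᵇ-refl e) (share₁-∉ C r′ s′ E e (Unique[x∷xs]⇒x∉xs uniq)) ⟩
      (A e + sumMap A E) ⊓ C e + 0
    ≡⟨ +-identityʳ _ ⟩
      (A e + sumMap A E) ⊓ C e
    ≡⟨ cong ((A e + sumMap A E) ⊓_) Ce≡Ae ⟩
      (A e + sumMap A E) ⊓ A e
    ≡⟨ m≥n⇒m⊓n≡n (m≤m+n (A e) _) ⟩
      A e
    ∎
    where open ≡-Reasoning
  step (there o∈E) =
    trans (cong₂ _+_ (if-≡ᵇ-≢ (unique-head-≢ uniq o∈E)) (cong₂ (λ r s → share₁ C r s E o) rest₁ rest₂))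
          (share₁-separated A B E o (AllPairs.tail uniq) sep o∈E)
share₁-separated A B (e ∷ E) o uniq (inj₂ A≡0) o∈E = step o∈E
  where
  C = λ e → A e + B e
  ΣA≡0 : sumMap A E ≡ 0
  ΣA≡0 = sumMap-zero A E A≡0
  pile₁-spent : (A e + sumMap A E) ∸ C e ≡ 0
  pile₁-spent rewrite ΣA≡0 | +-identityʳ (A e) = m≤n⇒m∸n≡0 (m≤m+n (A e) (B e))
  dealt : (A e + sumMap A E) ⊓ C e ≡ A e
  dealt rewrite ΣA≡0 | +-identityʳ (A e) = m≤n⇒m⊓n≡m (m≤m+n (A e) (B e))
  s′ = (B e + sumMap B E) ∸ (C e ∸ (A e + sumMap A E))
  rest : ∀ s → share₁ C ((A e + sumMap A E) ∸ C e) s E o ≡ 0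
  rest s rewrite pile₁-spent = share₁-zero C s E o
  step : o ∈ e ∷ E → share₁ C (A e + sumMap A E) (B e + sumMap B E) (e ∷ E) o ≡ A o
  step (here refl) = trans (cong₂ _+_ (trans (if-≡ᵇ-refl e) dealt) (rest s′)) (+-identityʳ (A e))
  step (there o∈E) = trans (cong₂ _+_ (if-≡ᵇ-≢ (unique-head-≢ uniq o∈E)) (rest s′)) (sym (All.lookup A≡0 o∈E))

module ByRank (rank : ℕ → ℕ) where

  Ascending : List ℕ → Set
  Ascending = AllPairs (λ x y → rank x < rank y)

  ascending⇒unique : ∀ {E} → Ascending E → Unique E
  ascending⇒unique = AllPairs.map (λ r<r x≡y → <-irrefl (cong rank x≡y) r<r)

  share₁-before-share₂ : ∀ C r s E o o′ → Ascending E →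
                         share₁ C r s E o ≢ 0 → share₂ C r s E o′ ≢ 0 → rank o ≤ rank o′
  share₁-before-share₂ C r s [] o o′ asc ≢0 _ = ⊥-elim (≢0 refl)
  share₁-before-share₂ C r s (e ∷ E) o o′ (e< ∷ asc) ≢0 ≢0′ with e ≡ᵇ o in e≟o
  ... | true with share₂-nonzero⇒∈ C r s (e ∷ E) o′ ≢0′
  ...   | here e≡o′    = ≤-reflexive (cong rank (trans (sym (≡ᵇ-true⇒≡ e≟o)) (sym e≡o′)))
  ...   | there o′∈E = subst (λ t → rank t ≤ rank o′) (≡ᵇ-true⇒≡ e≟o) (<⇒≤ (All.lookup e< o′∈E))
  share₁-before-share₂ C r s (e ∷ E) o o′ (e< ∷ asc) ≢0 ≢0′ | false with e ≡ᵇ o′ in e≟o′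
  ... | false = share₁-before-share₂ C (r ∸ C e) (s ∸ (C e ∸ r)) E o o′ asc ≢0 ≢0′
  ... | true  = ⊥-elim (≢0′ e-not-on-pile₂)
    where
    -- o ≠ e gets a card of the first pile only if e's copies did not exhaust it
    pile₁-left : r ∸ C e ≢ 0
    pile₁-left r′≡0 = ≢0 (subst (λ t → share₁ C t (s ∸ (C e ∸ r)) E o ≡ 0) (sym r′≡0) (share₁-zero C (s ∸ (C e ∸ r)) E o))
    none-on-pile₂ : C e ∸ r ≡ 0
    none-on-pile₂ = m≤n⇒m∸n≡0 (<⇒≤ (m∸n≢0⇒n<m {r} {C e} pile₁-left))
    e-not-on-pile₂ : s ⊓ (C e ∸ r) + share₂ C (r ∸ C e) (s ∸ (C e ∸ r)) E o′ ≡ 0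
    e-not-on-pile₂ rewrite none-on-pile₂ | ⊓-zeroʳ s =
      subst (λ t → share₂ C (r ∸ C e) s E t ≡ 0) (≡ᵇ-true⇒≡ e≟o′)
            (share₂-∉ C (r ∸ C e) s E e (Unique[x∷xs]⇒x∉xs (ascending⇒unique (e< ∷ asc))))

  separated-by-rank : ∀ (A B : ℕ → ℕ) E → Ascending E →
    (∀ {o o′} → o ∈ E → o′ ∈ E → A o ≢ 0 → B o′ ≢ 0 → rank o ≤ rank o′) → Separated A B E
  separated-by-rank A B []      asc A-before-B = tt
  separated-by-rank A B (e ∷ E) (e< ∷ asc) A-before-B with B e ≟ 0
  ... | yes Be≡0 = inj₁ (Be≡0 , separated-by-rank A B E asc (λ o∈E o′∈E → A-before-B (there o∈E) (there o′∈E)))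
  ... | no  Be≢0 = inj₂ (All.tabulate A≡0)
    where
    A≡0 : ∀ {x} → x ∈ E → A x ≡ 0
    A≡0 {x} x∈E with A x ≟ 0
    ... | yes Ax≡0 = Ax≡0
    ... | no  Ax≢0 = ⊥-elim (<⇒≱ (All.lookup e< x∈E) (A-before-B (there x∈E) (here refl) Ax≢0 Be≢0))

sumBelow : (ℕ → ℕ) → ℕ → ℕ
sumBelow f zero    = 0
sumBelow f (suc m) = f 0 + sumBelow (f ∘ suc) m

sumBelow-suc : ∀ f m → sumBelow f (suc m) ≡ sumBelow f m + f m
sumBelow-suc f zero    = +-comm (f 0) 0
sumBelow-suc f (suc m) = trans (cong (f 0 +_) (sumBelow-suc (f ∘ suc) m)) (sym (+-assoc (f 0) _ _))

sumBelow-reverse : ∀ f m → sumBelow f m ≡ sumBelow (λ j → f (m ∸ suc j)) m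
sumBelow-reverse f zero    = refl
sumBelow-reverse f (suc m) =
  trans (sumBelow-suc f m) (trans (+-comm (sumBelow f m) (f m)) (cong (f m +_) (sumBelow-reverse f m)))

sumBelow-+ : ∀ f a b → sumBelow f (a + b) ≡ sumBelow f a + sumBelow (λ j → f (a + j)) b
sumBelow-+ f zero    b = refl
sumBelow-+ f (suc a) b = trans (cong (f 0 +_) (sumBelow-+ (f ∘ suc) a b)) (sym (+-assoc (f 0) _ _))

sumBelow-cong : ∀ f g m → (∀ j → j < m → f j ≡ g j) → sumBelow f m ≡ sumBelow g m
sumBelow-cong f g zero    f≗g = refl
sumBelow-cong f g (suc m) f≗g =
  cong₂ _+_ (f≗g 0 z<s) (sumBelow-cong (f ∘ suc) (g ∘ suc) m (λ j j<m → f≗g (suc j) (s<s j<m)))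

sumMap-applyUpTo : ∀ {A : Set} (h : A → ℕ) (g : ℕ → A) m → sumMap h (applyUpTo g m) ≡ sumBelow (h ∘ g) m
sumMap-applyUpTo h g zero    = refl
sumMap-applyUpTo h g (suc m) = cong (h (g 0) +_) (sumMap-applyUpTo h (g ∘ suc) m)

reverse-upTo : ∀ k → reverse (upTo k) ≡ applyUpTo (λ j → k ∸ suc j) k
reverse-upTo zero    = refl
reverse-upTo (suc k) = begin
    reverse (upTo (suc k))
  ≡⟨ cong reverse (sym (List.applyUpTo-∷ʳ (λ j → j) k)) ⟩
    reverse (upTo k ++ k ∷ [])
  ≡⟨ List.reverse-++ (upTo k) (k ∷ []) ⟩
    k ∷ reverse (upTo k)
  ≡⟨ cong (k ∷_) (reverse-upTo k) ⟩
    applyUpTo (λ j → suc k ∸ suc j) (suc k)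
  ∎
  where open ≡-Reasoning

module OuterOrder (n k : ℕ) (k<n : suc k ≤ n) where

  #right : ℕ
  #right = n ∸ suc k

  suc-k+#right≡n : suc k + #right ≡ n
  suc-k+#right≡n = m+[n∸m]≡n k<n

  outer : List ℕ
  outer = reverse (upTo k) ++ map (n ∸_) (upTo #right)

  left right : ℕ → ℕ
  left j  = k ∸ suc j
  right j = n ∸ j

  outer≡ : outer ≡ applyUpTo left k ++ applyUpTo right #right
  outer≡ = cong₂ _++_ (reverse-upTo k) (List.map-applyUpTo (λ j → j) right #right)

  -- position along the chord, counted from its end next to position k
  rank : ℕ → ℕ
  rank o = if o <ᵇ k then k ∸ suc o else k + (n ∸ o)

  IsOuter : ℕ → Set
  IsOuter o = o ≤ n × (o < k ⊎ suc k < o)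

  left<k : ∀ {j} → j < k → left j < k
  left<k {j} j<k = ∸-monoʳ-< {k} {suc j} {0} z<s j<k

  left-involutive : ∀ {j} → j < k → left (left j) ≡ j
  left-involutive (s≤s j<k) = m∸[m∸n]≡n j<k

  rank-left : ∀ {j} → j < k → rank (left j) ≡ j
  rank-left j<k rewrite <⇒<ᵇ-true (left<k j<k) = left-involutive j<k

  right>suc-k : ∀ {j} → j < #right → suc k < right j
  right>suc-k {j} j<#right = m+n≤o⇒m≤o∸n (suc (suc k)) (subst (suc (suc k) + j ≤_) suc-k+#right≡n ssk+j≤sk+m)
    where
    ssk+j≤sk+m : suc (suc k) + j ≤ suc k + #right
    ssk+j≤sk+m = subst (_≤ suc k + #right) (cong suc (+-suc k j)) (+-monoʳ-≤ (suc k) j<#right)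

  rank-right : ∀ {j} → j < #right → rank (right j) ≡ k + j
  rank-right {j} j<#right rewrite ≥⇒<ᵇ-false {right j} {k} (<⇒≤ (<-trans (n<1+n k) (right>suc-k j<#right))) =
    cong (k +_) (m∸[m∸n]≡n (≤-trans (<⇒≤ j<#right) (subst (#right ≤_) suc-k+#right≡n (m≤n+m #right (suc k)))))

  outer-ascending : ByRank.Ascending rank outer
  outer-ascending = subst (ByRank.Ascending rank) (sym outer≡)
    (AllPairsₚ.++⁺
      (AllPairsₚ.applyUpTo⁺₁ left k (λ i<j j<k →
         subst₂ _<_ (sym (rank-left (<-trans i<j j<k))) (sym (rank-left j<k)) i<j))
      (AllPairsₚ.applyUpTo⁺₁ right #right (λ i<j j<#right →
         subst₂ _<_ (sym (rank-right (<-trans i<j j<#right))) (sym (rank-right j<#right)) (+-monoʳ-< k i<j)))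
      (Allₚ.applyUpTo⁺₁ left k (λ {i} i<k → Allₚ.applyUpTo⁺₁ right #right (λ {j} j<#right →
         subst₂ _<_ (sym (rank-left i<k)) (sym (rank-right j<#right)) (≤-trans i<k (m≤m+n k j))))))

  outer-unique : Unique outer
  outer-unique = ByRank.ascending⇒unique rank outer-ascending

  isOuter⇒∈ : ∀ {o} → IsOuter o → o ∈ outer
  isOuter⇒∈ {o} (o≤n , inj₁ o<k) = subst (o ∈_) (sym outer≡)
    (∈.∈-++⁺ˡ (subst (_∈ applyUpTo left k) (left-involutive o<k) (∈.∈-applyUpTo⁺ left (left<k o<k))))
  isOuter⇒∈ {o} (o≤n , inj₂ k<o) = subst (o ∈_) (sym outer≡)
    (∈.∈-++⁺ʳ (applyUpTo left k)
      (subst (_∈ applyUpTo right #right) (m∸[m∸n]≡n o≤n) (∈.∈-applyUpTo⁺ right (∸-monoʳ-< k<o o≤n))))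

  ∈⇒isOuter : ∀ {o} → o ∈ outer → IsOuter o
  ∈⇒isOuter {o} o∈ with ∈.∈-++⁻ (applyUpTo left k) (subst (o ∈_) outer≡ o∈)
  ... | inj₁ o∈left with ∈.∈-applyUpTo⁻ left o∈left
  ...   | j , j<k , refl = ≤-trans (<⇒≤ (left<k j<k)) (≤-trans (n≤1+n k) k<n) , inj₁ (left<k j<k)
  ∈⇒isOuter {o} o∈ | inj₂ o∈right with ∈.∈-applyUpTo⁻ right o∈right
  ...   | j , j<#right , refl = m∸n≤m n j , inj₂ (right>suc-k j<#right)

  right-reversed : ∀ j → j < #right → n ∸ (#right ∸ suc j) ≡ suc (suc k) + j
  right-reversed j j<#right = trans (cong (_∸ t) n≡) (m+n∸m≡n t _)
    where
    t = #right ∸ suc j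
    n≡ : n ≡ t + (suc (suc k) + j)
    n≡ = trans (sym suc-k+#right≡n) (trans (cong (suc k +_) (sym (m∸n+n≡m j<#right)))
           (solve 3 (λ K T J → con 1 :+ K :+ (T :+ (con 1 :+ J)) := T :+ (con 2 :+ K :+ J)) refl k t j))

  sumBelow-outer : ∀ h → sumBelow h (suc n) ≡ h k + h (suc k) + sumMap h outer
  sumBelow-outer h = begin
      sumBelow h (suc n)
    ≡⟨ cong (λ t → sumBelow h (suc t)) (sym suc-k+#right≡n) ⟩
      sumBelow h (suc (suc k + #right))
    ≡⟨ cong (sumBelow h) (solve 2 (λ K M → con 2 :+ K :+ M := K :+ (con 2 :+ M)) refl k #right) ⟩
      sumBelow h (k + suc (suc #right))
    ≡⟨ sumBelow-+ h k (suc (suc #right)) ⟩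
      sumBelow h k + (h (k + 0) + (h (k + 1) + beyond))
    ≡⟨ cong₂ (λ a b → sumBelow h k + (h a + (h b + beyond))) (+-identityʳ k) (+-comm k 1) ⟩
      sumBelow h k + (h k + (h (suc k) + beyond))
    ≡⟨ solve 4 (λ a b c d → a :+ (b :+ (c :+ d)) := b :+ c :+ (a :+ d)) refl (sumBelow h k) (h k) (h (suc k)) beyond ⟩
      h k + h (suc k) + (sumBelow h k + beyond)
    ≡⟨ cong (h k + h (suc k) +_) (sym (cong₂ _+_ sum-left sum-right)) ⟩
      h k + h (suc k) + (sumMap h (applyUpTo left k) + sumMap h (applyUpTo right #right))
    ≡⟨ cong (h k + h (suc k) +_) (sym (trans (cong (sumMap h) outer≡) (sumMap-++ h (applyUpTo left k) _))) ⟩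
      h k + h (suc k) + sumMap h outer
    ∎
    where
    open ≡-Reasoning
    beyond = sumBelow (λ j → h (k + suc (suc j))) #right
    sum-left : sumMap h (applyUpTo left k) ≡ sumBelow h k
    sum-left = trans (sumMap-applyUpTo h left k) (sym (sumBelow-reverse h k))
    sum-right : sumMap h (applyUpTo right #right) ≡ beyond
    sum-right = trans (sumMap-applyUpTo h right #right) (trans (sumBelow-reverse (h ∘ right) #right)
      (sumBelow-cong _ _ #right (λ j j<#right → cong h (trans (right-reversed j j<#right)
        (sym (trans (+-suc k (suc j)) (cong suc (+-suc k j))))))))

  rank-below : ∀ {o} → o < k → rank o ≡ k ∸ suc o
  rank-below o<k rewrite <⇒<ᵇ-true o<k = refl

  rank-above : ∀ {o} → k ≤ o → rank o ≡ k + (n ∸ o)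
  rank-above {o} k≤o rewrite ≥⇒<ᵇ-false {o} {k} k≤o = refl

  rank-below<k : ∀ {o} → o < k → rank o < k
  rank-below<k {o} o<k rewrite rank-below o<k = ∸-monoʳ-< {k} {suc o} {0} z<s o<k

  rank-inversion : ∀ {o o′} → IsOuter o → IsOuter o′ → rank o′ < rank o →
                   (o < o′ × o′ < k) ⊎ (suc k < o × o < o′) ⊎ (o′ < k × suc k < o)
  rank-inversion {o} {o′} (_ , inj₁ o<k) (_ , inj₁ o′<k) r′<r with o <? o′
  ... | yes o<o′ = inj₁ (o<o′ , o′<k)
  ... | no  o≮o′ = ⊥-elim (<⇒≱ (subst₂ _<_ (rank-below o′<k) (rank-below o<k) r′<r) (∸-monoʳ-≤ k (s≤s (≮⇒≥ o≮o′))))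
  rank-inversion {o} {o′} (_ , inj₁ o<k) (_ , inj₂ k<o′) r′<r =
    ⊥-elim (<⇒≱ (rank-below<k o<k)
      (≤-trans (m≤m+n k (n ∸ o′)) (<⇒≤ (subst (_< rank o) (rank-above (<⇒≤ (<-trans (n<1+n k) k<o′))) r′<r))))
  rank-inversion {o} {o′} (_ , inj₂ k<o) (_ , inj₁ o′<k) r′<r = inj₂ (inj₂ (o′<k , k<o))
  rank-inversion {o} {o′} (_ , inj₂ k<o) (o′≤n , inj₂ k<o′) r′<r with o <? o′
  ... | yes o<o′ = inj₂ (inj₁ (k<o , o<o′))
  ... | no  o≮o′ = ⊥-elim (<⇒≱
          (+-cancelˡ-< k _ _ (subst₂ _<_ (rank-above (<⇒≤ (<-trans (n<1+n k) k<o′))) (rank-above (<⇒≤ (<-trans (n<1+n k) k<o))) r′<r))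
          (∸-monoʳ-≤ n (≮⇒≥ o≮o′)))

  rank-right-descending : ∀ {c d} → suc k < c → c < d → d ≤ n → rank d < rank c
  rank-right-descending {c} {d} k<c c<d d≤n
    rewrite rank-above (<⇒≤ (<-trans (n<1+n k) k<c)) | rank-above (<⇒≤ (<-trans (n<1+n k) (<-trans k<c c<d))) =
    +-monoʳ-< k (∸-monoʳ-< c<d d≤n)

  rank-left-descending : ∀ {a b} → a < b → b < k → rank b < rank a
  rank-left-descending {a} {b} a<b b<k rewrite rank-below (<-trans a<b b<k) | rank-below b<k = ∸-monoʳ-< (s≤s a<b) b<k

  rank-left<rank-right : ∀ {a d} → a < k → suc k < d → rank a < rank d
  rank-left<rank-right {a} {d} a<k k<d rewrite rank-above (<⇒≤ (<-trans (n<1+n k) k<d)) =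
    <-≤-trans (rank-below<k a<k) (m≤m+n k _)

record ArcSystem (n : ℕ) (m : ℕ → ℕ → ℕ) : Set where
  field
    symmetric   : ∀ a b → a ≤ n → b ≤ n → m a b ≡ m b a
    loopless    : ∀ a → a ≤ n → m a a ≡ 0
    noncrossing : ∀ a b c d → a < b → b < c → c < d → d ≤ n → m a c ≡ 0 ⊎ m b d ≡ 0
open ArcSystem public

<⇒≤n : ∀ {n x y} → x < y → y ≤ n → x ≤ n
<⇒≤n x<y y≤n = ≤-trans (<⇒≤ x<y) y≤n

Agree : ℕ → (ℕ → ℕ → ℕ) → (ℕ → ℕ → ℕ) → Set
Agree n m m′ = ∀ a b → a ≤ n → b ≤ n → m a b ≡ m′ a b

agree-sym : ∀ {n m m′} → Agree n m m′ → Agree n m′ m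
agree-sym m≐m′ a b a≤n b≤n = sym (m≐m′ a b a≤n b≤n)

agree-trans : ∀ {n m m′ m″} → Agree n m m′ → Agree n m′ m″ → Agree n m m″
agree-trans m≐m′ m′≐m″ a b a≤n b≤n = trans (m≐m′ a b a≤n b≤n) (m′≐m″ a b a≤n b≤n)

arcSystem-cong : ∀ {n m m′} → Agree n m m′ → ArcSystem n m → ArcSystem n m′
arcSystem-cong {n} m≐m′ arcs = record
  { symmetric   = λ a b a≤n b≤n → trans (sym (m≐m′ a b a≤n b≤n)) (trans (symmetric arcs a b a≤n b≤n) (m≐m′ b a b≤n a≤n))
  ; loopless    = λ a a≤n → trans (sym (m≐m′ a a a≤n a≤n)) (loopless arcs a a≤n)
  ; noncrossing = λ a b c d a<b b<c c<d d≤n →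
      Sum.map (trans (sym (m≐m′ a c (<⇒≤n (<-trans a<b (<-trans b<c c<d)) d≤n) (<⇒≤n c<d d≤n))))
                   (trans (sym (m≐m′ b d (<⇒≤n (<-trans b<c c<d) d≤n) d≤n)))
                   (noncrossing arcs a b c d a<b b<c c<d d≤n)
  }

degree : ℕ → (ℕ → ℕ → ℕ) → ℕ → ℕ
degree n m a = sumBelow (m a) (suc n)

degree-cong : ∀ {n m m′} → Agree n m m′ → ∀ a → a ≤ n → degree n m a ≡ degree n m′ a
degree-cong {n} {m} {m′} m≐m′ a a≤n = sumBelow-cong (m a) (m′ a) (suc n) (λ b b<1+n → m≐m′ a b a≤n (≤-pred b<1+n))

pairsTo : (ℕ → ℕ) → ℕ → List ℕ → List (ℕ × ℕ)
pairsTo h i = concatMap (λ o → replicate (h o) (o , i))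

map-proj₁-pairsTo : ∀ h i L → map proj₁ (pairsTo h i L) ≡ copies h L
map-proj₁-pairsTo h i []      = refl
map-proj₁-pairsTo h i (o ∷ L) = trans (List.map-++ proj₁ (replicate (h o) (o , i)) _)
  (cong₂ _++_ (List.map-replicate proj₁ (h o) (o , i)) (map-proj₁-pairsTo h i L))

map-proj₂-pairsTo : ∀ (f h : ℕ → ℕ) i L → map (f ∘ proj₂) (pairsTo h i L) ≡ replicate (sumMap h L) (f i)
map-proj₂-pairsTo f h i []      = refl
map-proj₂-pairsTo f h i (o ∷ L) = trans (List.map-++ (f ∘ proj₂) (replicate (h o) (o , i)) _)
  (trans (cong₂ _++_ (List.map-replicate (f ∘ proj₂) (h o) (o , i)) (map-proj₂-pairsTo f h i L))
         (sym (replicate-+ (h o) _ (f i))))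

reverse-replicate : ∀ {A : Set} a (x : A) → reverse (replicate a x) ≡ replicate a x
reverse-replicate zero    x = refl
reverse-replicate (suc a) x = begin
    reverse (x ∷ replicate a x)
  ≡⟨ List.unfold-reverse x (replicate a x) ⟩
    reverse (replicate a x) ++ x ∷ []
  ≡⟨ cong (_++ x ∷ []) (reverse-replicate a x) ⟩
    replicate a x ++ replicate 1 x
  ≡⟨ sym (replicate-+ a 1 x) ⟩
    replicate (a + 1) x
  ≡⟨ cong (λ t → replicate t x) (+-comm a 1) ⟩
    replicate (suc a) x
  ∎
  where open ≡-Reasoning

reverse-replicate-++ : ∀ {A : Set} a b (x y : A) → reverse (replicate a x ++ replicate b y) ≡ replicate b y ++ replicate a x
reverse-replicate-++ a b x y = trans (List.reverse-++ (replicate a x) (replicate b y))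
  (cong₂ _++_ (reverse-replicate b y) (reverse-replicate a x))

concatMap-cong-∈ : ∀ {A B : Set} (f g : A → List B) L → (∀ {o} → o ∈ L → f o ≡ g o) → concatMap f L ≡ concatMap g L
concatMap-cong-∈ f g []      f≗g = refl
concatMap-cong-∈ f g (x ∷ L) f≗g = cong₂ _++_ (f≗g (here refl)) (concatMap-cong-∈ f g L (f≗g ∘ there))

-- The generator s_{k,k+1} acting on an arc system

module Adjacent (n k : ℕ) (k<n : suc k ≤ n) where
  open OuterOrder n k k<n public
  open ByRank rank public

  k≤n : k ≤ n
  k≤n = ≤-trans (n≤1+n k) k<n

  inner : ℕ → Bool
  inner = inBlock k (suc k)

  reflect : ℕ → ℕ
  reflect = reflℕ k (suc k)

  inner? : ∀ a → inner a ≡ true ⊎ inner a ≡ false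
  inner? a with inner a
  ... | true  = inj₁ refl
  ... | false = inj₂ refl

  inner-k : inner k ≡ true
  inner-k rewrite ≤⇒≤ᵇ-true (≤-refl {k}) | ≤⇒≤ᵇ-true (n≤1+n k) = refl

  inner-suc-k : inner (suc k) ≡ true
  inner-suc-k rewrite ≤⇒≤ᵇ-true (n≤1+n k) | ≤⇒≤ᵇ-true (≤-refl {suc k}) = refl

  inner⇒ : ∀ {a} → inner a ≡ true → a ≡ k ⊎ a ≡ suc k
  inner⇒ {a} a∈ with k ≤ᵇ a in k≤?a | a ≤ᵇ suc k in a≤?sk
  inner⇒ {a} () | false | _
  inner⇒ {a} () | true  | false
  ... | true | true with m≤n⇒m<n∨m≡n (≤ᵇ-true⇒≤ a≤?sk)
  ...   | inj₂ a≡sk        = inj₂ a≡sk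
  ...   | inj₁ (s≤s a≤k) = inj₁ (≤-antisym a≤k (≤ᵇ-true⇒≤ k≤?a))

  ¬inner⇒ : ∀ {a} → inner a ≡ false → a < k ⊎ suc k < a
  ¬inner⇒ {a} a∉ with k ≤ᵇ a in k≤?a | a ≤ᵇ suc k in a≤?sk
  ... | false | _     = inj₁ (≤ᵇ-false⇒> k≤?a)
  ... | true  | false = inj₂ (≤ᵇ-false⇒> a≤?sk)
  ¬inner⇒ {a} () | true | true

  outside⇒¬inner : ∀ {a} → a < k ⊎ suc k < a → inner a ≡ false
  outside⇒¬inner (inj₁ a<k) rewrite >⇒≤ᵇ-false a<k = refl
  outside⇒¬inner (inj₂ k<a) rewrite ≤⇒≤ᵇ-true (≤-trans (n≤1+n k) (<⇒≤ k<a)) | >⇒≤ᵇ-false k<a = refl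

  inner-bounds : ∀ {a} → inner a ≡ true → k ≤ a × a ≤ suc k
  inner-bounds a∈ with inner⇒ a∈
  ... | inj₁ refl = ≤-refl , n≤1+n k
  ... | inj₂ refl = n≤1+n k , ≤-refl

  inner⇒≤n : ∀ {a} → inner a ≡ true → a ≤ n
  inner⇒≤n a∈ = ≤-trans (proj₂ (inner-bounds a∈)) k<n

  isOuter : ∀ {a} → a ≤ n → inner a ≡ false → IsOuter a
  isOuter a≤n a∉ = a≤n , ¬inner⇒ a∉

  ∈outer⇒≤n : ∀ {o} → o ∈ outer → o ≤ n
  ∈outer⇒≤n o∈ = proj₁ (∈⇒isOuter o∈)

  ∈outer⇒¬inner : ∀ {o} → o ∈ outer → inner o ≡ false
  ∈outer⇒¬inner o∈ = outside⇒¬inner (proj₂ (∈⇒isOuter o∈))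

  outer-before-inner : ∀ {x y} → inner x ≡ false → inner y ≡ true → x < y → x < k
  outer-before-inner x∉ y∈ x<y with ¬inner⇒ x∉
  ... | inj₁ x<k = x<k
  ... | inj₂ k<x = ⊥-elim (<⇒≱ (<-trans k<x x<y) (proj₂ (inner-bounds y∈)))

  outer-after-inner : ∀ {x y} → inner x ≡ false → inner y ≡ true → y < x → suc k < x
  outer-after-inner x∉ y∈ y<x with ¬inner⇒ x∉
  ... | inj₂ k<x = k<x
  ... | inj₁ x<k = ⊥-elim (<⇒≱ (<-trans y<x x<k) (proj₁ (inner-bounds y∈)))

  nothing-between-inner : ∀ {x y z} → inner x ≡ true → inner z ≡ true → x < y → y < z → ⊥
  nothing-between-inner x∈ z∈ x<y y<z =
    <⇒≱ (≤-trans (s≤s (≤-trans (s≤s (proj₁ (inner-bounds x∈))) x<y)) y<z) (proj₂ (inner-bounds z∈))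

  inner-ordered : ∀ {x y} → inner x ≡ true → inner y ≡ true → x < y → x ≡ k × y ≡ suc k
  inner-ordered x∈ y∈ x<y =
    ≤-antisym (≤-pred (≤-trans x<y (proj₂ (inner-bounds y∈)))) (proj₁ (inner-bounds x∈)) ,
    ≤-antisym (proj₂ (inner-bounds y∈)) (≤-trans (s≤s (proj₁ (inner-bounds x∈))) x<y)

  reflect-k : reflect k ≡ suc k
  reflect-k rewrite inner-k = m+n∸m≡n k (suc k)

  reflect-suc-k : reflect (suc k) ≡ k
  reflect-suc-k rewrite inner-suc-k = m+n∸n≡m k (suc k)

  reflect-outer : ∀ {a} → inner a ≡ false → reflect a ≡ a
  reflect-outer a∉ rewrite a∉ = refl

  reflect-inner : ∀ {a} → inner a ≡ true → inner (reflect a) ≡ true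
  reflect-inner a∈ with inner⇒ a∈
  ... | inj₁ refl rewrite reflect-k     = inner-suc-k
  ... | inj₂ refl rewrite reflect-suc-k = inner-k

  reflect-involutive : ∀ {a} → inner a ≡ true → reflect (reflect a) ≡ a
  reflect-involutive a∈ with inner⇒ a∈
  ... | inj₁ refl rewrite reflect-k     = reflect-suc-k
  ... | inj₂ refl rewrite reflect-suc-k = reflect-k

  innerOrder : List ℕ
  innerOrder = map (k +_) (upTo (suc (suc k ∸ k)))

  innerOrder≡ : innerOrder ≡ k ∷ suc k ∷ []
  innerOrder≡ rewrite m+n∸n≡m 1 k | +-identityʳ k | +-comm k 1 = refl

  crossing : (ℕ → ℕ → ℕ) → List (ℕ × ℕ)
  crossing m = concatMap (λ i → pairsTo (λ o → m o i) i outer) innerOrder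

  rejoined : (ℕ → ℕ → ℕ) → List (ℕ × ℕ)
  rejoined m = zip (map proj₁ (crossing m)) (reverse (map (λ c → reflect (proj₂ c)) (crossing m)))

  flipMult : (ℕ → ℕ → ℕ) → ℕ → ℕ → ℕ
  flipMult m a b with inner a | inner b
  ... | true  | true  = m (k + suc k ∸ a) (k + suc k ∸ b)
  ... | false | false = m a b
  ... | false | true  = count (rejoined m) a b
  ... | true  | false = count (rejoined m) b a

  flipMult-inner-inner : ∀ m {a b} → inner a ≡ true → inner b ≡ true → flipMult m a b ≡ m (reflect a) (reflect b)
  flipMult-inner-inner m {a} {b} a∈ b∈ = trans unfolded (cong₂ m (reflect-inner≡ a∈) (reflect-inner≡ b∈))
    where
    reflect-inner≡ : ∀ {x} → inner x ≡ true → k + suc k ∸ x ≡ reflect x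
    reflect-inner≡ x∈ rewrite x∈ = refl
    unfolded : flipMult m a b ≡ m (k + suc k ∸ a) (k + suc k ∸ b)
    unfolded rewrite a∈ | b∈ = refl

  flipMult-outer-outer : ∀ m {a b} → inner a ≡ false → inner b ≡ false → flipMult m a b ≡ m a b
  flipMult-outer-outer m a∉ b∉ rewrite a∉ | b∉ = refl

  flipMult-outer-inner : ∀ m {a b} → inner a ≡ false → inner b ≡ true → flipMult m a b ≡ count (rejoined m) a b
  flipMult-outer-inner m a∉ b∈ rewrite a∉ | b∈ = refl

  flipMult-inner-outer : ∀ m {a b} → inner a ≡ true → inner b ≡ false → flipMult m a b ≡ count (rejoined m) b a
  flipMult-inner-outer m a∈ b∉ rewrite a∈ | b∉ = refl

  toK toK+1 toPair : (ℕ → ℕ → ℕ) → ℕ → ℕ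
  toK m o = m o k
  toK+1 m o = m o (suc k)
  toPair m o = m o k + m o (suc k)

  ΣtoK ΣtoK+1 : (ℕ → ℕ → ℕ) → ℕ
  ΣtoK m = sumMap (toK m) outer
  ΣtoK+1 m = sumMap (toK+1 m) outer

  crossing≡ : ∀ m → crossing m ≡ pairsTo (toK m) k outer ++ pairsTo (toK+1 m) (suc k) outer
  crossing≡ m = trans (cong (concatMap (λ i → pairsTo (λ o → m o i) i outer)) innerOrder≡)
                      (cong (pairsTo (toK m) k outer ++_) (List.++-identityʳ _))

  -- The crossing arcs keep their outer ends; the first ΣtoK+1 m of them (along the chord) now end at k.
  rejoined≡ : ∀ m → rejoined m ≡ zip (copies (toK m) outer ++ copies (toK+1 m) outer)
                                      (replicate (ΣtoK+1 m) k ++ replicate (ΣtoK m) (suc k))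
  rejoined≡ m = cong₂ zip outer-ends inner-ends
    where
    open ≡-Reasoning
    outer-ends : map proj₁ (crossing m) ≡ copies (toK m) outer ++ copies (toK+1 m) outer
    outer-ends = begin
        map proj₁ (crossing m)
      ≡⟨ cong (map proj₁) (crossing≡ m) ⟩
        map proj₁ (pairsTo (toK m) k outer ++ pairsTo (toK+1 m) (suc k) outer)
      ≡⟨ List.map-++ proj₁ (pairsTo (toK m) k outer) _ ⟩
        map proj₁ (pairsTo (toK m) k outer) ++ map proj₁ (pairsTo (toK+1 m) (suc k) outer)
      ≡⟨ cong₂ _++_ (map-proj₁-pairsTo (toK m) k outer) (map-proj₁-pairsTo (toK+1 m) (suc k) outer) ⟩
        copies (toK m) outer ++ copies (toK+1 m) outer
      ∎
    inner-ends : reverse (map (reflect ∘ proj₂) (crossing m)) ≡ replicate (ΣtoK+1 m) k ++ replicate (ΣtoK m) (suc k)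
    inner-ends = begin
        reverse (map (reflect ∘ proj₂) (crossing m))
      ≡⟨ cong (reverse ∘ map (reflect ∘ proj₂)) (crossing≡ m) ⟩
        reverse (map (reflect ∘ proj₂) (pairsTo (toK m) k outer ++ pairsTo (toK+1 m) (suc k) outer))
      ≡⟨ cong reverse (List.map-++ (reflect ∘ proj₂) (pairsTo (toK m) k outer) _) ⟩
        reverse (map (reflect ∘ proj₂) (pairsTo (toK m) k outer) ++ map (reflect ∘ proj₂) (pairsTo (toK+1 m) (suc k) outer))
      ≡⟨ cong₂ (λ x y → reverse (x ++ y)) (map-proj₂-pairsTo reflect (toK m) k outer) (map-proj₂-pairsTo reflect (toK+1 m) (suc k) outer) ⟩
        reverse (replicate (ΣtoK m) (reflect k) ++ replicate (ΣtoK+1 m) (reflect (suc k)))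
      ≡⟨ cong₂ (λ x y → reverse (replicate (ΣtoK m) x ++ replicate (ΣtoK+1 m) y)) reflect-k reflect-suc-k ⟩
        reverse (replicate (ΣtoK m) (suc k) ++ replicate (ΣtoK+1 m) k)
      ≡⟨ reverse-replicate-++ (ΣtoK m) (ΣtoK+1 m) (suc k) k ⟩
        replicate (ΣtoK+1 m) k ++ replicate (ΣtoK m) (suc k)
      ∎

  -- Along the chord, every arc ending at k comes before every arc ending at k+1, else two arcs would cross.
  arcs-separated : ∀ m → ArcSystem n m → Separated (toK m) (toK+1 m) outer
  arcs-separated m arcs = separated-by-rank (toK m) (toK+1 m) outer outer-ascending ordered
    where
    ordered : ∀ {o o′} → o ∈ outer → o′ ∈ outer → m o k ≢ 0 → m o′ (suc k) ≢ 0 → rank o ≤ rank o′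
    ordered {o} {o′} o∈ o′∈ ok≢0 o′sk≢0 with rank o ≤? rank o′
    ... | yes r≤r′ = r≤r′
    ... | no  r≰r′ with rank-inversion (∈⇒isOuter o∈) (∈⇒isOuter o′∈) (≰⇒> r≰r′)
    ...   | inj₁ (o<o′ , o′<k) =
      ⊥-elim ([ ok≢0 , o′sk≢0 ]′ (noncrossing arcs o o′ k (suc k) o<o′ o′<k (n<1+n k) k<n))
    ...   | inj₂ (inj₁ (k<o , o<o′)) =
      ⊥-elim ([ ok≢0 ∘ trans (symmetric arcs o k (∈outer⇒≤n o∈) k≤n) , o′sk≢0 ∘ trans (symmetric arcs o′ (suc k) (∈outer⇒≤n o′∈) k<n) ]′
                (noncrossing arcs k (suc k) o o′ (n<1+n k) k<o o<o′ (∈outer⇒≤n o′∈)))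
    ...   | inj₂ (inj₂ (o′<k , k<o)) =
      ⊥-elim ([ o′sk≢0 , ok≢0 ∘ trans (symmetric arcs o k (∈outer⇒≤n o∈) k≤n) ]′
                (noncrossing arcs o′ k (suc k) o o′<k (n<1+n k) k<o (∈outer⇒≤n o∈)))

  open CountZip k (suc k) (<⇒≢ (n<1+n k))

  dealtK dealtK+1 : (ℕ → ℕ → ℕ) → ℕ → ℕ
  dealtK m = share₁ (toPair m) (ΣtoK+1 m) (ΣtoK m) outer
  dealtK+1 m = share₂ (toPair m) (ΣtoK+1 m) (ΣtoK m) outer

  count-rejoined-k : ∀ m → ArcSystem n m → ∀ o → count (rejoined m) o k ≡ dealtK m o
  count-rejoined-k m arcs o rewrite rejoined≡ m | copies-++-separated (toK m) (toK+1 m) outer (arcs-separated m arcs) =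
    count-zip-copies₁ (toPair m) outer (ΣtoK+1 m) (ΣtoK m) o

  count-rejoined-suc-k : ∀ m → ArcSystem n m → ∀ o → count (rejoined m) o (suc k) ≡ dealtK+1 m o
  count-rejoined-suc-k m arcs o rewrite rejoined≡ m | copies-++-separated (toK m) (toK+1 m) outer (arcs-separated m arcs) =
    count-zip-copies₂ (toPair m) outer (ΣtoK+1 m) (ΣtoK m) o

  flipMult-outer-k : ∀ m → ArcSystem n m → ∀ {o} → inner o ≡ false → flipMult m o k ≡ dealtK m o
  flipMult-outer-k m arcs o∉ = trans (flipMult-outer-inner m o∉ inner-k) (count-rejoined-k m arcs _)

  flipMult-k-outer : ∀ m → ArcSystem n m → ∀ {o} → inner o ≡ false → flipMult m k o ≡ dealtK m o
  flipMult-k-outer m arcs o∉ = trans (flipMult-inner-outer m inner-k o∉) (count-rejoined-k m arcs _)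

  flipMult-outer-suc-k : ∀ m → ArcSystem n m → ∀ {o} → inner o ≡ false → flipMult m o (suc k) ≡ dealtK+1 m o
  flipMult-outer-suc-k m arcs o∉ = trans (flipMult-outer-inner m o∉ inner-suc-k) (count-rejoined-suc-k m arcs _)

  flipMult-suc-k-outer : ∀ m → ArcSystem n m → ∀ {o} → inner o ≡ false → flipMult m (suc k) o ≡ dealtK+1 m o
  flipMult-suc-k-outer m arcs o∉ = trans (flipMult-inner-outer m inner-suc-k o∉) (count-rejoined-suc-k m arcs _)

  ΣtoK+1+ΣtoK≡ : ∀ m → ΣtoK+1 m + ΣtoK m ≡ sumMap (toPair m) outer
  ΣtoK+1+ΣtoK≡ m = trans (+-comm (ΣtoK+1 m) (ΣtoK m)) (sym (sumMap-+ (toK m) (toK+1 m) outer))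

  dealtK+dealtK+1 : ∀ m → ∀ {o} → IsOuter o → dealtK m o + dealtK+1 m o ≡ toPair m o
  dealtK+dealtK+1 m O = share₁+share₂ (toPair m) (ΣtoK+1 m) (ΣtoK m) outer _ outer-unique (isOuter⇒∈ O) (ΣtoK+1+ΣtoK≡ m)

  sumMap-dealtK : ∀ m → sumMap (dealtK m) outer ≡ ΣtoK+1 m
  sumMap-dealtK m = sumMap-share₁ (toPair m) (ΣtoK+1 m) (ΣtoK m) outer outer-unique (ΣtoK+1+ΣtoK≡ m)

  sumMap-dealtK+1 : ∀ m → sumMap (dealtK+1 m) outer ≡ ΣtoK m
  sumMap-dealtK+1 m = sumMap-share₂ (toPair m) (ΣtoK+1 m) (ΣtoK m) outer outer-unique (ΣtoK+1+ΣtoK≡ m)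

  dealtK-before-dealtK+1 : ∀ m {o o′} → dealtK m o ≢ 0 → dealtK+1 m o′ ≢ 0 → rank o ≤ rank o′
  dealtK-before-dealtK+1 m {o} {o′} = share₁-before-share₂ (toPair m) (ΣtoK+1 m) (ΣtoK m) outer o o′ outer-ascending

  flipMult-arc-lifts : ∀ m → ArcSystem n m → ∀ {x o} → inner x ≡ true → inner o ≡ false → o ≤ n →
                       flipMult m x o ≢ 0 → Σ ℕ (λ x′ → k ≤ x′ × x′ ≤ suc k × m x′ o ≢ 0)
  flipMult-arc-lifts m arcs {x} {o} x∈ o∉ o≤n xo≢0 with m o k ≟ 0
  ... | no  ok≢0 = k , ≤-refl , n≤1+n k , ok≢0 ∘ trans (symmetric arcs o k o≤n k≤n)
  ... | yes ok≡0 = suc k , n≤1+n k , ≤-refl ,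
                   λ sko≡0 → pair≢0 (trans (cong (_+ m o (suc k)) ok≡0) (trans (symmetric arcs o (suc k) o≤n k<n) sko≡0))
    where
    pair≢0 : toPair m o ≢ 0
    pair≢0 pair≡0 with inner⇒ x∈ | dealtK+dealtK+1 m (isOuter o≤n o∉)
    ... | inj₁ refl | split = xo≢0 (trans (flipMult-k-outer m arcs o∉) (m+n≡0⇒m≡0 (dealtK m o) (trans split pair≡0)))
    ... | inj₂ refl | split = xo≢0 (trans (flipMult-suc-k-outer m arcs o∉) (m+n≡0⇒n≡0 (dealtK m o) (trans split pair≡0)))

  flipMult-symmetric : ∀ m → ArcSystem n m → ∀ a b → a ≤ n → b ≤ n → flipMult m a b ≡ flipMult m b a
  flipMult-symmetric m arcs a b a≤n b≤n with inner? a | inner? b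
  ... | inj₁ a∈ | inj₁ b∈ = trans (flipMult-inner-inner m a∈ b∈)
      (trans (symmetric arcs _ _ (inner⇒≤n (reflect-inner a∈)) (inner⇒≤n (reflect-inner b∈))) (sym (flipMult-inner-inner m b∈ a∈)))
  ... | inj₂ a∉ | inj₂ b∉ = trans (flipMult-outer-outer m a∉ b∉) (trans (symmetric arcs a b a≤n b≤n) (sym (flipMult-outer-outer m b∉ a∉)))
  ... | inj₂ a∉ | inj₁ b∈ = trans (flipMult-outer-inner m a∉ b∈) (sym (flipMult-inner-outer m b∈ a∉))
  ... | inj₁ a∈ | inj₂ b∉ = trans (flipMult-inner-outer m a∈ b∉) (sym (flipMult-outer-inner m b∉ a∈))

  -- Crossings in flipMult m with both ends k and k+1 among the four points contradict the order in which
  -- the crossing arcs were dealt.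
  pair-then-outer : ∀ m → ArcSystem n m → ∀ {c d} → suc k < c → c < d → d ≤ n →
                    flipMult m k c ≢ 0 → flipMult m (suc k) d ≢ 0 → ⊥
  pair-then-outer m arcs k<c c<d d≤n kc≢0 skd≢0 =
    <⇒≱ (rank-right-descending k<c c<d d≤n)
        (dealtK-before-dealtK+1 m (kc≢0 ∘ trans (flipMult-k-outer m arcs (outside⇒¬inner (inj₂ k<c))))
                                  (skd≢0 ∘ trans (flipMult-suc-k-outer m arcs (outside⇒¬inner (inj₂ (<-trans k<c c<d))))))

  outer-pair-outer : ∀ m → ArcSystem n m → ∀ {a d} → a < k → suc k < d →
                     flipMult m a (suc k) ≢ 0 → flipMult m k d ≢ 0 → ⊥
  outer-pair-outer m arcs a<k k<d ask≢0 kd≢0 =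
    <⇒≱ (rank-left<rank-right a<k k<d)
        (dealtK-before-dealtK+1 m (kd≢0 ∘ trans (flipMult-k-outer m arcs (outside⇒¬inner (inj₂ k<d))))
                                  (ask≢0 ∘ trans (flipMult-outer-suc-k m arcs (outside⇒¬inner (inj₁ a<k)))))

  outer-then-pair : ∀ m → ArcSystem n m → ∀ {a b} → a < b → b < k →
                    flipMult m a k ≢ 0 → flipMult m b (suc k) ≢ 0 → ⊥
  outer-then-pair m arcs a<b b<k ak≢0 bsk≢0 =
    <⇒≱ (rank-left-descending a<b b<k)
        (dealtK-before-dealtK+1 m (ak≢0 ∘ trans (flipMult-outer-k m arcs (outside⇒¬inner (inj₁ (<-trans a<b b<k)))))
                                  (bsk≢0 ∘ trans (flipMult-outer-suc-k m arcs (outside⇒¬inner (inj₁ b<k)))))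

  flipMult-noncrossing : ∀ m → ArcSystem n m → ∀ a b c d → a < b → b < c → c < d → d ≤ n →
                         flipMult m a c ≢ 0 → flipMult m b d ≢ 0 → ⊥
  flipMult-noncrossing m arcs a b c d a<b b<c c<d d≤n ac≢0 bd≢0 with inner? a | inner? b | inner? c | inner? d
  ... | inj₂ a∉ | inj₂ b∉ | inj₂ c∉ | inj₂ d∉ =
    [ ac≢0 ∘ trans (flipMult-outer-outer m a∉ c∉) , bd≢0 ∘ trans (flipMult-outer-outer m b∉ d∉) ]′
      (noncrossing arcs a b c d a<b b<c c<d d≤n)
  ... | inj₁ a∈ | inj₂ b∉ | inj₂ c∉ | inj₂ d∉ with flipMult-arc-lifts m arcs a∈ c∉ (<⇒≤n c<d d≤n) ac≢0
  ...   | x , _ , x≤sk , xc≢0 =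
    [ xc≢0 , bd≢0 ∘ trans (flipMult-outer-outer m b∉ d∉) ]′
      (noncrossing arcs x b c d (≤-trans (s≤s x≤sk) (outer-after-inner b∉ a∈ a<b)) b<c c<d d≤n)
  flipMult-noncrossing m arcs a b c d a<b b<c c<d d≤n ac≢0 bd≢0 | inj₂ a∉ | inj₁ b∈ | inj₂ c∉ | inj₂ d∉
    with flipMult-arc-lifts m arcs b∈ d∉ d≤n bd≢0
  ...   | x , k≤x , x≤sk , xd≢0 =
    [ ac≢0 ∘ trans (flipMult-outer-outer m a∉ c∉) , xd≢0 ]′
      (noncrossing arcs a x c d (≤-trans (outer-before-inner a∉ b∈ a<b) k≤x)
                                (≤-trans (s≤s x≤sk) (outer-after-inner c∉ b∈ b<c)) c<d d≤n)
  flipMult-noncrossing m arcs a b c d a<b b<c c<d d≤n ac≢0 bd≢0 | inj₂ a∉ | inj₂ b∉ | inj₁ c∈ | inj₂ d∉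
    with flipMult-arc-lifts m arcs c∈ a∉ (<⇒≤n (<-trans a<b b<c) (<⇒≤n c<d d≤n)) (ac≢0 ∘ trans (flipMult-symmetric m arcs a c (<⇒≤n (<-trans a<b b<c) (<⇒≤n c<d d≤n)) (<⇒≤n c<d d≤n)))
  ...   | x , k≤x , x≤sk , xa≢0 =
    [ xa≢0 ∘ trans (symmetric arcs x a (≤-trans x≤sk k<n) (<⇒≤n (<-trans a<b b<c) (<⇒≤n c<d d≤n))) , bd≢0 ∘ trans (flipMult-outer-outer m b∉ d∉) ]′
      (noncrossing arcs a b x d a<b (≤-trans (outer-before-inner b∉ c∈ b<c) k≤x)
                                (≤-trans (s≤s x≤sk) (outer-after-inner d∉ c∈ c<d)) d≤n)
  flipMult-noncrossing m arcs a b c d a<b b<c c<d d≤n ac≢0 bd≢0 | inj₂ a∉ | inj₂ b∉ | inj₂ c∉ | inj₁ d∈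
    with flipMult-arc-lifts m arcs d∈ b∉ (<⇒≤n (<-trans b<c c<d) d≤n) (bd≢0 ∘ trans (flipMult-symmetric m arcs b d (<⇒≤n (<-trans b<c c<d) d≤n) d≤n))
  ...   | x , k≤x , x≤sk , xb≢0 =
    [ ac≢0 ∘ trans (flipMult-outer-outer m a∉ c∉) , xb≢0 ∘ trans (symmetric arcs x b (≤-trans x≤sk k<n) (<⇒≤n (<-trans b<c c<d) d≤n)) ]′
      (noncrossing arcs a b c x a<b b<c (≤-trans (outer-before-inner c∉ d∈ c<d) k≤x) (≤-trans x≤sk k<n))
  flipMult-noncrossing m arcs a b c d a<b b<c c<d d≤n ac≢0 bd≢0 | inj₁ a∈ | inj₁ b∈ | inj₂ c∉ | inj₂ d∉
    with inner-ordered a∈ b∈ a<b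
  ... | refl , refl = pair-then-outer m arcs (outer-after-inner c∉ a∈ (<-trans a<b b<c)) c<d d≤n ac≢0 bd≢0
  flipMult-noncrossing m arcs a b c d a<b b<c c<d d≤n ac≢0 bd≢0 | inj₂ a∉ | inj₁ b∈ | inj₁ c∈ | inj₂ d∉
    with inner-ordered b∈ c∈ b<c
  ... | refl , refl = outer-pair-outer m arcs (outer-before-inner a∉ b∈ a<b) (outer-after-inner d∉ c∈ c<d) ac≢0 bd≢0
  flipMult-noncrossing m arcs a b c d a<b b<c c<d d≤n ac≢0 bd≢0 | inj₂ a∉ | inj₂ b∉ | inj₁ c∈ | inj₁ d∈
    with inner-ordered c∈ d∈ c<d
  ... | refl , refl = outer-then-pair m arcs a<b (outer-before-inner b∉ c∈ b<c) ac≢0 bd≢0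
  flipMult-noncrossing m arcs a b c d a<b b<c c<d d≤n ac≢0 bd≢0 | inj₁ a∈ | _ | inj₁ c∈ | _ =
    nothing-between-inner a∈ c∈ a<b b<c
  flipMult-noncrossing m arcs a b c d a<b b<c c<d d≤n ac≢0 bd≢0 | inj₁ a∈ | _ | _ | inj₁ d∈ =
    nothing-between-inner a∈ d∈ a<b (<-trans b<c c<d)
  flipMult-noncrossing m arcs a b c d a<b b<c c<d d≤n ac≢0 bd≢0 | _ | inj₁ b∈ | _ | inj₁ d∈ =
    nothing-between-inner b∈ d∈ b<c c<d

  flipMult-arcSystem : ∀ m → ArcSystem n m → ArcSystem n (flipMult m)
  flipMult-arcSystem m arcs = record
    { symmetric   = flipMult-symmetric m arcs
    ; loopless    = loopless′
    ; noncrossing = noncrossing′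
    }
    where
    loopless′ : ∀ a → a ≤ n → flipMult m a a ≡ 0
    loopless′ a a≤n with inner? a
    ... | inj₁ a∈ = trans (flipMult-inner-inner m a∈ a∈) (loopless arcs _ (inner⇒≤n (reflect-inner a∈)))
    ... | inj₂ a∉ = trans (flipMult-outer-outer m a∉ a∉) (loopless arcs a a≤n)
    noncrossing′ : ∀ a b c d → a < b → b < c → c < d → d ≤ n → flipMult m a c ≡ 0 ⊎ flipMult m b d ≡ 0
    noncrossing′ a b c d a<b b<c c<d d≤n with flipMult m a c ≟ 0 | flipMult m b d ≟ 0
    ... | yes ac≡0 | _         = inj₁ ac≡0
    ... | no  _    | yes bd≡0 = inj₂ bd≡0
    ... | no  ac≢0 | no  bd≢0 = ⊥-elim (flipMult-noncrossing m arcs a b c d a<b b<c c<d d≤n ac≢0 bd≢0)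

  dealt-in-original-piles : ∀ m → ArcSystem n m → ∀ {o} → IsOuter o →
    share₁ (toPair m) (ΣtoK m) (ΣtoK+1 m) outer o ≡ m o k × share₂ (toPair m) (ΣtoK m) (ΣtoK+1 m) outer o ≡ m o (suc k)
  dealt-in-original-piles m arcs {o} O = first , second
    where
    first : share₁ (toPair m) (ΣtoK m) (ΣtoK+1 m) outer o ≡ m o k
    first = share₁-separated (toK m) (toK+1 m) outer o outer-unique (arcs-separated m arcs) (isOuter⇒∈ O)
    second : share₂ (toPair m) (ΣtoK m) (ΣtoK+1 m) outer o ≡ m o (suc k)
    second = +-cancelˡ-≡ (m o k) _ _ (trans (cong (_+ share₂ (toPair m) (ΣtoK m) (ΣtoK+1 m) outer o) (sym first))
      (share₁+share₂ (toPair m) (ΣtoK m) (ΣtoK+1 m) outer o outer-unique (isOuter⇒∈ O)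
                     (trans (+-comm (ΣtoK m) (ΣtoK+1 m)) (ΣtoK+1+ΣtoK≡ m))))

  flipMult-restores : ∀ m → ArcSystem n m → ∀ m₀ → ArcSystem n m₀ →
    (∀ {o} → o ∈ outer → toPair m o ≡ toPair m₀ o) → ΣtoK+1 m ≡ ΣtoK m₀ → ΣtoK m ≡ ΣtoK+1 m₀ →
    ∀ {a b} → a ≤ n → inner a ≡ false → inner b ≡ true → flipMult m a b ≡ m₀ a b
  flipMult-restores m arcs m₀ arcs₀ same-pairs piles₁ piles₂ {a} a≤n a∉ b∈
    with inner⇒ b∈ | dealt-in-original-piles m₀ arcs₀ (isOuter a≤n a∉)
  ... | inj₁ refl | original , _ = trans (flipMult-outer-k m arcs a∉)
    (trans (share₁-cong (toPair m) (toPair m₀) (ΣtoK+1 m) (ΣtoK m) outer a same-pairs)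
    (trans (cong₂ (λ r s → share₁ (toPair m₀) r s outer a) piles₁ piles₂) original))
  ... | inj₂ refl | _ , original = trans (flipMult-outer-suc-k m arcs a∉)
    (trans (share₂-cong (toPair m) (toPair m₀) (ΣtoK+1 m) (ΣtoK m) outer a same-pairs)
    (trans (cong₂ (λ r s → share₂ (toPair m₀) r s outer a) piles₁ piles₂) original))

  flipMult-agrees : ∀ m → ArcSystem n m → ∀ m₀ → ArcSystem n m₀ →
    (∀ {o} → o ∈ outer → toPair m o ≡ toPair m₀ o) → ΣtoK+1 m ≡ ΣtoK m₀ → ΣtoK m ≡ ΣtoK+1 m₀ →
    (∀ {a b} → inner a ≡ true → inner b ≡ true → m (reflect a) (reflect b) ≡ m₀ a b) →
    (∀ {a b} → inner a ≡ false → inner b ≡ false → m a b ≡ m₀ a b) →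
    Agree n (flipMult m) m₀
  flipMult-agrees m arcs m₀ arcs₀ same-pairs piles₁ piles₂ inner-agree outer-agree a b a≤n b≤n with inner? a | inner? b
  ... | inj₁ a∈ | inj₁ b∈ = trans (flipMult-inner-inner m a∈ b∈) (inner-agree a∈ b∈)
  ... | inj₂ a∉ | inj₂ b∉ = trans (flipMult-outer-outer m a∉ b∉) (outer-agree a∉ b∉)
  ... | inj₂ a∉ | inj₁ b∈ = flipMult-restores m arcs m₀ arcs₀ same-pairs piles₁ piles₂ a≤n a∉ b∈
  ... | inj₁ a∈ | inj₂ b∉ = trans (flipMult-symmetric m arcs a b a≤n b≤n)
    (trans (flipMult-restores m arcs m₀ arcs₀ same-pairs piles₁ piles₂ b≤n b∉ a∈) (symmetric arcs₀ b a b≤n a≤n))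

  toPair-flipMult : ∀ m → ArcSystem n m → ∀ {o} → o ∈ outer → toPair (flipMult m) o ≡ toPair m o
  toPair-flipMult m arcs o∈ =
    trans (cong₂ _+_ (flipMult-outer-k m arcs (∈outer⇒¬inner o∈)) (flipMult-outer-suc-k m arcs (∈outer⇒¬inner o∈)))
          (dealtK+dealtK+1 m (∈⇒isOuter o∈))

  ΣtoK-flipMult : ∀ m → ArcSystem n m → ΣtoK (flipMult m) ≡ ΣtoK+1 m
  ΣtoK-flipMult m arcs = trans (sumMap-cong outer (flipMult-outer-k m arcs ∘ ∈outer⇒¬inner)) (sumMap-dealtK m)

  ΣtoK+1-flipMult : ∀ m → ArcSystem n m → ΣtoK+1 (flipMult m) ≡ ΣtoK m
  ΣtoK+1-flipMult m arcs = trans (sumMap-cong outer (flipMult-outer-suc-k m arcs ∘ ∈outer⇒¬inner)) (sumMap-dealtK+1 m)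

  flipMult-involutive : ∀ m → ArcSystem n m → Agree n (flipMult (flipMult m)) m
  flipMult-involutive m arcs =
    flipMult-agrees (flipMult m) (flipMult-arcSystem m arcs) m arcs
      (toPair-flipMult m arcs) (ΣtoK+1-flipMult m arcs) (ΣtoK-flipMult m arcs)
      (λ a∈ b∈ → trans (flipMult-inner-inner m (reflect-inner a∈) (reflect-inner b∈))
                       (cong₂ m (reflect-involutive a∈) (reflect-involutive b∈)))
      (flipMult-outer-outer m)

  sumMap-row≡column : ∀ m → ArcSystem n m → ∀ x → x ≤ n → sumMap (m x) outer ≡ sumMap (λ o → m o x) outer
  sumMap-row≡column m arcs x x≤n = sumMap-cong outer (λ o∈ → symmetric arcs x _ x≤n (∈outer⇒≤n o∈))

  degree-k : ∀ m → ArcSystem n m → degree n m k ≡ m k (suc k) + ΣtoK m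
  degree-k m arcs = begin
      degree n m k
    ≡⟨ sumBelow-outer (m k) ⟩
      m k k + m k (suc k) + sumMap (m k) outer
    ≡⟨ cong₂ (λ x y → x + m k (suc k) + y) (loopless arcs k k≤n) (sumMap-row≡column m arcs k k≤n) ⟩
      m k (suc k) + ΣtoK m
    ∎
    where open ≡-Reasoning

  degree-suc-k : ∀ m → ArcSystem n m → degree n m (suc k) ≡ m k (suc k) + ΣtoK+1 m
  degree-suc-k m arcs = begin
      degree n m (suc k)
    ≡⟨ sumBelow-outer (m (suc k)) ⟩
      m (suc k) k + m (suc k) (suc k) + sumMap (m (suc k)) outer
    ≡⟨ cong₂ _+_ (cong₂ _+_ (symmetric arcs (suc k) k k<n k≤n) (loopless arcs (suc k) k<n))
                 (sumMap-row≡column m arcs (suc k) k<n) ⟩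
      m k (suc k) + 0 + ΣtoK+1 m
    ≡⟨ cong (_+ ΣtoK+1 m) (+-identityʳ (m k (suc k))) ⟩
      m k (suc k) + ΣtoK+1 m
    ∎
    where open ≡-Reasoning

  degree-flipMult-suc-k : ∀ m → ArcSystem n m → degree n (flipMult m) (suc k) ≡ degree n m k
  degree-flipMult-suc-k m arcs = begin
      degree n (flipMult m) (suc k)
    ≡⟨ degree-suc-k (flipMult m) (flipMult-arcSystem m arcs) ⟩
      flipMult m k (suc k) + ΣtoK+1 (flipMult m)
    ≡⟨ cong₂ _+_ (flipMult-inner-inner m inner-k inner-suc-k) (ΣtoK+1-flipMult m arcs) ⟩
      m (reflect k) (reflect (suc k)) + ΣtoK m
    ≡⟨ cong (_+ ΣtoK m) (trans (cong₂ m reflect-k reflect-suc-k) (symmetric arcs (suc k) k k<n k≤n)) ⟩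
      m k (suc k) + ΣtoK m
    ≡⟨ sym (degree-k m arcs) ⟩
      degree n m k
    ∎
    where open ≡-Reasoning

  degree-flipMult-beyond : ∀ m → ArcSystem n m → ∀ d → suc k < d → d ≤ n → degree n (flipMult m) d ≡ degree n m d
  degree-flipMult-beyond m arcs d k<d d≤n = begin
      degree n (flipMult m) d
    ≡⟨ sumBelow-outer (flipMult m d) ⟩
      flipMult m d k + flipMult m d (suc k) + sumMap (flipMult m d) outer
    ≡⟨ cong₂ _+_ (trans (cong₂ _+_ (flipMult-outer-k m arcs d∉) (flipMult-outer-suc-k m arcs d∉))
                        (dealtK+dealtK+1 m (isOuter d≤n d∉)))
                 (sumMap-cong outer (flipMult-outer-outer m d∉ ∘ ∈outer⇒¬inner)) ⟩
      m d k + m d (suc k) + sumMap (m d) outer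
    ≡⟨ sym (sumBelow-outer (m d)) ⟩
      degree n m d
    ∎
    where
    open ≡-Reasoning
    d∉ = outside⇒¬inner (inj₂ k<d)

  pair-reflect-invariant : ∀ m → ArcSystem n m → ∀ {a b} → inner a ≡ true → inner b ≡ true →
                           m (reflect a) (reflect b) ≡ m a b
  pair-reflect-invariant m arcs a∈ b∈ with inner⇒ a∈ | inner⇒ b∈
  ... | inj₁ refl | inj₁ refl rewrite reflect-k = trans (loopless arcs (suc k) k<n) (sym (loopless arcs k k≤n))
  ... | inj₁ refl | inj₂ refl rewrite reflect-k | reflect-suc-k = symmetric arcs (suc k) k k<n k≤n
  ... | inj₂ refl | inj₁ refl rewrite reflect-k | reflect-suc-k = symmetric arcs k (suc k) k≤n k<n
  ... | inj₂ refl | inj₂ refl rewrite reflect-suc-k = trans (loopless arcs k k≤n) (sym (loopless arcs (suc k) k<n))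

  flipMult-fixes : ∀ m → ArcSystem n m → degree n m k ≡ degree n m (suc k) → Agree n (flipMult m) m
  flipMult-fixes m arcs deg≡ =
    flipMult-agrees m arcs m arcs (λ _ → refl) (sym ΣtoK≡ΣtoK+1) ΣtoK≡ΣtoK+1
      (pair-reflect-invariant m arcs) (λ _ _ → refl)
    where
    ΣtoK≡ΣtoK+1 : ΣtoK m ≡ ΣtoK+1 m
    ΣtoK≡ΣtoK+1 = +-cancelˡ-≡ (m k (suc k)) _ _ (trans (sym (degree-k m arcs)) (trans deg≡ (degree-suc-k m arcs)))

  rejoined-cong : ∀ m m′ → Agree n m m′ → rejoined m ≡ rejoined m′
  rejoined-cong m m′ m≐m′ = cong (λ L → zip (map proj₁ L) (reverse (map (reflect ∘ proj₂) L))) same-crossing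
    where
    same-pairs : ∀ i → i ≤ n → pairsTo (λ o → m o i) i outer ≡ pairsTo (λ o → m′ o i) i outer
    same-pairs i i≤n = concatMap-cong-∈ _ _ outer (λ o∈ → cong (λ t → replicate t _) (m≐m′ _ i (∈outer⇒≤n o∈) i≤n))
    same-crossing : crossing m ≡ crossing m′
    same-crossing = trans (crossing≡ m) (trans (cong₂ _++_ (same-pairs k k≤n) (same-pairs (suc k) k<n)) (sym (crossing≡ m′)))

  flipMult-cong : ∀ m m′ → Agree n m m′ → Agree n (flipMult m) (flipMult m′)
  flipMult-cong m m′ m≐m′ a b a≤n b≤n with inner? a | inner? b
  ... | inj₁ a∈ | inj₁ b∈ = trans (flipMult-inner-inner m a∈ b∈)
      (trans (m≐m′ _ _ (inner⇒≤n (reflect-inner a∈)) (inner⇒≤n (reflect-inner b∈))) (sym (flipMult-inner-inner m′ a∈ b∈)))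
  ... | inj₂ a∉ | inj₂ b∉ = trans (flipMult-outer-outer m a∉ b∉) (trans (m≐m′ a b a≤n b≤n) (sym (flipMult-outer-outer m′ a∉ b∉)))
  ... | inj₂ a∉ | inj₁ b∈ = trans (flipMult-outer-inner m a∉ b∈)
      (trans (cong (λ L → count L a b) (rejoined-cong m m′ m≐m′)) (sym (flipMult-outer-inner m′ a∉ b∈)))
  ... | inj₁ a∈ | inj₂ b∉ = trans (flipMult-inner-outer m a∈ b∉)
      (trans (cong (λ L → count L b a) (rejoined-cong m m′ m≐m′)) (sym (flipMult-inner-outer m′ a∈ b∉)))

  ¬inner⇒≢k : ∀ {a} → inner a ≡ false → a ≢ k
  ¬inner⇒≢k a∉ refl with trans (sym inner-k) a∉
  ... | ()

  ¬inner⇒≢suc-k : ∀ {a} → inner a ≡ false → a ≢ suc k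
  ¬inner⇒≢suc-k a∉ refl with trans (sym inner-suc-k) a∉
  ... | ()

toℕ-clamp : ∀ n a → a ≤ n → toℕ (clamp n a) ≡ a
toℕ-clamp n a a≤n with a <? suc n
... | yes a<1+n = Fin.toℕ-fromℕ< a<1+n
... | no  a≮1+n = ⊥-elim (a≮1+n (s≤s a≤n))

clamp-toℕ : ∀ n (a : Fin (suc n)) → clamp n (toℕ a) ≡ a
clamp-toℕ n a with toℕ a <? suc n
... | yes a<1+n = Fin.fromℕ<-toℕ a a<1+n
... | no  a≮1+n = ⊥-elim (a≮1+n (Fin.toℕ<n a))

matrix : ∀ {n} → Raw n → ℕ → ℕ → ℕ
matrix {n} x a b = mult x (clamp n a) (clamp n b)

diagram-arcSystem : ∀ {n l l∞} (x : Diagram n l l∞) → ArcSystem n (matrix (raw x))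
diagram-arcSystem {n} x = record
  { symmetric   = λ a b _ _ → symm x (clamp n a) (clamp n b)
  ; loopless    = λ a _ → no-loop x (clamp n a)
  ; noncrossing = λ a b c d a<b b<c c<d d≤n →
      let c≤n = <⇒≤n c<d d≤n ; b≤n = <⇒≤n b<c c≤n ; a≤n = <⇒≤n a<b b≤n in
      noncross x (clamp n a) (clamp n b) (clamp n c) (clamp n d)
        (subst₂ _<_ (sym (toℕ-clamp n a a≤n)) (sym (toℕ-clamp n b b≤n)) a<b)
        (subst₂ _<_ (sym (toℕ-clamp n b b≤n)) (sym (toℕ-clamp n c c≤n)) b<c)
        (subst₂ _<_ (sym (toℕ-clamp n c c≤n)) (sym (toℕ-clamp n d d≤n)) c<d)
  }

sum-tabulate : ∀ m (h : Fin m → ℕ) (h′ : ℕ → ℕ) → (∀ i → h i ≡ h′ (toℕ i)) → sum (tabulate h) ≡ sumBelow h′ m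
sum-tabulate zero    h h′ h≗h′ = refl
sum-tabulate (suc m) h h′ h≗h′ = cong₂ _+_ (h≗h′ zero) (sum-tabulate m (h ∘ suc) (h′ ∘ suc) (h≗h′ ∘ suc))

deg≡degree : ∀ {n} (x : Raw n) (a : Fin (suc n)) → deg x a ≡ degree n (matrix x) (toℕ a)
deg≡degree {n} x a = sum-tabulate (suc n) (mult x a) (matrix x (toℕ a))
  (λ b → sym (cong₂ (mult x) (clamp-toℕ n a) (clamp-toℕ n b)))

adjacentGen : ∀ {n} k → 1 ≤ k → suc k ≤ n → Gen n
adjacentGen k 1≤k k<n = s[_,_] k (suc k) {1≤k} {n<1+n k} {k<n}

act-adjacent : ∀ {n} k (1≤k : 1 ≤ k) (k<n : suc k ≤ n) (x : Raw n) →
               Agree n (matrix (act (adjacentGen k 1≤k k<n) x)) (Adjacent.flipMult n k k<n (matrix x))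
act-adjacent {n} k 1≤k k<n x a b a≤n b≤n =
  trans (from-action (clamp n a) (clamp n b)) (cong₂ (Adjacent.flipMult n k k<n (matrix x)) (toℕ-clamp n a a≤n) (toℕ-clamp n b b≤n))
  where
  reflℕ-inner : ∀ {a} → inBlock k (suc k) a ≡ true → reflℕ k (suc k) a ≡ k + suc k ∸ a
  reflℕ-inner a∈ rewrite a∈ = refl
  from-action : ∀ a b → Action.newMult k (suc k) x a b ≡ Adjacent.flipMult n k k<n (matrix x) (toℕ a) (toℕ b)
  from-action a b with inBlock k (suc k) (toℕ a) in a∈ | inBlock k (suc k) (toℕ b) in b∈
  ... | true  | true  = cong₂ (matrix x) (reflℕ-inner a∈) (reflℕ-inner b∈)
  ... | false | false = sym (cong₂ (mult x) (clamp-toℕ n a) (clamp-toℕ n b))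
  ... | false | true  = refl
  ... | true  | false = refl

≈R-trans : ∀ {n} {x y z : Raw n} → x ≈R y → y ≈R z → x ≈R z
≈R-trans (lab≡ , mult≡) (lab≡′ , mult≡′) = (λ a → trans (lab≡ a) (lab≡′ a)) , (λ a b → trans (mult≡ a b) (mult≡′ a b))

act-cong : ∀ {n} (g : Gen n) {x y : Raw n} → x ≈R y → act g x ≈R act g y
act-cong {n} s[ p , q ] {x} {y} (lab≡ , mult≡) = (λ a → lab≡ _) , newMult≡
  where
  module X = Action p q x
  module Y = Action p q y
  multℕ≡ : ∀ a b → X.multℕ a b ≡ Y.multℕ a b
  multℕ≡ a b = mult≡ (clamp n a) (clamp n b)
  newCrossing≡ : X.newCrossing ≡ Y.newCrossing
  newCrossing≡ = cong (λ L → zip (map proj₁ L) (reverse (map (λ c → reflℕ p q (proj₂ c)) L)))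
    (List.concatMap-cong (λ i → List.concatMap-cong (λ o → cong (λ t → replicate t (o , i)) (multℕ≡ o i)) X.outerOrder) X.innerOrder)
  newMult≡ : ∀ a b → X.newMult a b ≡ Y.newMult a b
  newMult≡ a b with inBlock p q (toℕ a) | inBlock p q (toℕ b)
  ... | true  | true  = multℕ≡ (reflℕ p q (toℕ a)) (reflℕ p q (toℕ b))
  ... | false | false = mult≡ a b
  ... | false | true  = cong (λ L → count L (toℕ a) (toℕ b)) newCrossing≡
  ... | true  | false = cong (λ L → count L (toℕ b) (toℕ a)) newCrossing≡

actW-cong : ∀ {n} (w : List (Gen n)) {x y : Raw n} → x ≈R y → actW w x ≈R actW w y
actW-cong []      x≈y = x≈y
actW-cong (g ∷ w) x≈y = act-cong g (actW-cong w x≈y)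

actW-++ : ∀ {n} (u v : List (Gen n)) (x : Raw n) → actW (u ++ v) x ≡ actW u (actW v x)
actW-++ []      v x = refl
actW-++ (g ∷ u) v x = cong (act g) (actW-++ u v x)

source : ∀ {n} → Gen n → Fin (suc n) → Fin (suc n)
source {n} s[ p , q ] a = clamp n (reflℕ p q (toℕ a))

sourceW : ∀ {n} → List (Gen n) → Fin (suc n) → Fin (suc n)
sourceW []      a = a
sourceW (g ∷ w) a = sourceW w (source g a)

lab-actW : ∀ {n} (w : List (Gen n)) (x : Raw n) a → lab (actW w x) a ≡ lab x (sourceW w a)
lab-actW []                x a = refl
lab-actW (s[ p , q ] ∷ w) x a = lab-actW w x _

sourceW-++ : ∀ {n} (u v : List (Gen n)) a → sourceW (u ++ v) a ≡ sourceW v (sourceW u a)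
sourceW-++ []      v a = refl
sourceW-++ (g ∷ u) v a = sourceW-++ u v (source g a)

-- Transposing the labels of two positions of equal degree

swapℕ : ℕ → ℕ → ℕ → ℕ
swapℕ i j a = if a ≡ᵇ i then j else (if a ≡ᵇ j then i else a)

swapℕ-fst : ∀ i j → swapℕ i j i ≡ j
swapℕ-fst i j rewrite ≡ᵇ-refl i = refl

swapℕ-snd : ∀ i j → i ≢ j → swapℕ i j j ≡ i
swapℕ-snd i j i≢j rewrite ≢⇒≡ᵇ-false (i≢j ∘ sym) | ≡ᵇ-refl j = refl

swapℕ-other : ∀ i j a → a ≢ i → a ≢ j → swapℕ i j a ≡ a
swapℕ-other i j a a≢i a≢j rewrite ≢⇒≡ᵇ-false a≢i | ≢⇒≡ᵇ-false a≢j = refl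

swapℕ-≤ : ∀ {n} i j a → i ≤ n → j ≤ n → a ≤ n → swapℕ i j a ≤ n
swapℕ-≤ i j a i≤n j≤n a≤n with a ≡ᵇ i
... | true  = j≤n
... | false with a ≡ᵇ j
...   | true  = i≤n
...   | false = a≤n

swapℕ-involutive : ∀ i j a → i ≢ j → swapℕ i j (swapℕ i j a) ≡ a
swapℕ-involutive i j a i≢j with a ≟ i
... | yes refl rewrite swapℕ-fst a j = swapℕ-snd a j i≢j
... | no  a≢i with a ≟ j
...   | yes refl rewrite swapℕ-snd i a i≢j = swapℕ-fst i a
...   | no  a≢j rewrite swapℕ-other i j a a≢i a≢j = swapℕ-other i j a a≢i a≢j

swapℕ-conjugate : ∀ i j a → suc i < j → swapℕ i (suc i) (swapℕ (suc i) j (swapℕ i (suc i) a)) ≡ swapℕ i j a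
swapℕ-conjugate i j a si<j with a ≟ i
... | yes refl rewrite swapℕ-fst a (suc a) | swapℕ-fst (suc a) j | swapℕ-fst a j =
  swapℕ-other a (suc a) j (>⇒≢ (<-trans (n<1+n a) si<j)) (>⇒≢ si<j)
... | no  a≢i with a ≟ suc i
...   | yes refl rewrite swapℕ-snd i (suc i) (<⇒≢ (n<1+n i))
                       | swapℕ-other (suc i) j i (<⇒≢ (n<1+n i)) (<⇒≢ (<-trans (n<1+n i) si<j))
                       | swapℕ-fst i (suc i) =
  sym (swapℕ-other i j (suc i) (>⇒≢ (n<1+n i)) (<⇒≢ si<j))
...   | no  a≢si with a ≟ j
...     | yes refl rewrite swapℕ-other i (suc i) a a≢i a≢si | swapℕ-snd (suc i) a (<⇒≢ si<j)
                         | swapℕ-snd i (suc i) (<⇒≢ (n<1+n i))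
                         | swapℕ-snd i a (<⇒≢ (<-trans (n<1+n i) si<j)) = refl
...     | no  a≢j rewrite swapℕ-other i (suc i) a a≢i a≢si | swapℕ-other (suc i) j a a≢si a≢j
                        | swapℕ-other i (suc i) a a≢i a≢si | swapℕ-other i j a a≢i a≢j = refl

module _ (n k : ℕ) (k<n : suc k ≤ n) where
  open Adjacent n k k<n

  reflect≡swapℕ : ∀ a → reflect a ≡ swapℕ k (suc k) a
  reflect≡swapℕ a with inner? a
  ... | inj₂ a∉ = trans (reflect-outer a∉) (sym (swapℕ-other k (suc k) a (¬inner⇒≢k a∉) (¬inner⇒≢suc-k a∉)))
  ... | inj₁ a∈ with inner⇒ a∈
  ...   | inj₁ refl = trans reflect-k (sym (swapℕ-fst k (suc k)))
  ...   | inj₂ refl = trans reflect-suc-k (sym (swapℕ-snd k (suc k) (<⇒≢ (n<1+n k))))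

source-adjacent : ∀ {n} i (1≤i : 1 ≤ i) (i<n : suc i ≤ n) a →
                  toℕ (source (adjacentGen i 1≤i i<n) a) ≡ swapℕ i (suc i) (toℕ a)
source-adjacent {n} i 1≤i i<n a =
  trans (toℕ-clamp n _ (subst (_≤ n) (sym reflect≡swap) (swapℕ-≤ i (suc i) (toℕ a) (<⇒≤ i<n) i<n (Fin.toℕ≤pred[n] a))))
        reflect≡swap
  where
  reflect≡swap = reflect≡swapℕ n i i<n (toℕ a)

record Transposes {n} (i j : ℕ) (x : Raw n) (w : List (Gen n)) : Set where
  field
    positions : ∀ a → toℕ (sourceW w a) ≡ swapℕ i j (toℕ a)
    arcs-kept : Agree n (matrix (actW w x)) (matrix x)

module Conjugation {n} i (1≤i : 1 ≤ i) (i<n : suc i ≤ n) where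
  open Adjacent n i i<n using (flipMult; flipMult-cong; flipMult-involutive; flipMult-arcSystem; degree-flipMult-suc-k; degree-flipMult-beyond)

  g : Gen n
  g = adjacentGen i 1≤i i<n

  conjugate-positions : ∀ j → suc i < j → (w : List (Gen n)) → (∀ a → toℕ (sourceW w a) ≡ swapℕ (suc i) j (toℕ a)) →
                        ∀ a → toℕ (sourceW (g ∷ w ++ g ∷ []) a) ≡ swapℕ i j (toℕ a)
  conjugate-positions j si<j w w-swaps a = begin
      toℕ (sourceW (w ++ g ∷ []) (source g a))
    ≡⟨ cong toℕ (sourceW-++ w (g ∷ []) (source g a)) ⟩
      toℕ (source g (sourceW w (source g a)))
    ≡⟨ source-adjacent i 1≤i i<n _ ⟩
      swapℕ i (suc i) (toℕ (sourceW w (source g a)))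
    ≡⟨ cong (swapℕ i (suc i)) (w-swaps (source g a)) ⟩
      swapℕ i (suc i) (swapℕ (suc i) j (toℕ (source g a)))
    ≡⟨ cong (swapℕ i (suc i) ∘ swapℕ (suc i) j) (source-adjacent i 1≤i i<n a) ⟩
      swapℕ i (suc i) (swapℕ (suc i) j (swapℕ i (suc i) (toℕ a)))
    ≡⟨ swapℕ-conjugate i j (toℕ a) si<j ⟩
      swapℕ i j (toℕ a)
    ∎
    where open ≡-Reasoning

  act-arcSystem : (x : Raw n) → ArcSystem n (matrix x) → ArcSystem n (matrix (act g x))
  act-arcSystem x arcs = arcSystem-cong (agree-sym (act-adjacent i 1≤i i<n x)) (flipMult-arcSystem (matrix x) arcs)

  act-degrees : (x : Raw n) → ArcSystem n (matrix x) → ∀ j → suc i < j → j ≤ n →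
                degree n (matrix x) i ≡ degree n (matrix x) j → degree n (matrix (act g x)) (suc i) ≡ degree n (matrix (act g x)) j
  act-degrees x arcs j si<j j≤n deg≡ = begin
      degree n (matrix (act g x)) (suc i)
    ≡⟨ degree-cong (act-adjacent i 1≤i i<n x) (suc i) i<n ⟩
      degree n (flipMult (matrix x)) (suc i)
    ≡⟨ degree-flipMult-suc-k (matrix x) arcs ⟩
      degree n (matrix x) i
    ≡⟨ deg≡ ⟩
      degree n (matrix x) j
    ≡⟨ sym (degree-flipMult-beyond (matrix x) arcs j si<j j≤n) ⟩
      degree n (flipMult (matrix x)) j
    ≡⟨ sym (degree-cong (act-adjacent i 1≤i i<n x) j j≤n) ⟩
      degree n (matrix (act g x)) j
    ∎
    where open ≡-Reasoning

  conjugate-arcs : (x : Raw n) → ArcSystem n (matrix x) → (w : List (Gen n)) →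
                   Agree n (matrix (actW w (act g x))) (matrix (act g x)) →
                   Agree n (matrix (actW (g ∷ w ++ g ∷ []) x)) (matrix x)
  conjugate-arcs x arcs w w-keeps =
    subst (λ y → Agree n (matrix (act g y)) (matrix x)) (sym (actW-++ w (g ∷ []) x))
      (agree-trans (act-adjacent i 1≤i i<n (actW w (act g x)))
      (agree-trans (flipMult-cong _ _ (agree-trans w-keeps (act-adjacent i 1≤i i<n x)))
                   (flipMult-involutive (matrix x) arcs)))

-- s_{i,i+1} fixes the arcs when i and i+1 have equal degree, and conjugating by it moves i to i+1.
transposition-at-distance : ∀ {n} d i → 1 ≤ i → i + suc d ≤ n → (x : Raw n) → ArcSystem n (matrix x) →
  degree n (matrix x) i ≡ degree n (matrix x) (i + suc d) → Σ (List (Gen n)) (Transposes i (i + suc d) x)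
transposition-at-distance {n} zero i 1≤i i+1≤n x arcs deg≡ = g ∷ [] , record
  { positions = λ a → subst (λ t → toℕ (source g a) ≡ swapℕ i t (toℕ a)) (sym i+1≡) (source-adjacent i 1≤i i<n a)
  ; arcs-kept = agree-trans (act-adjacent i 1≤i i<n x)
                  (Adjacent.flipMult-fixes n i i<n (matrix x) arcs (trans deg≡ (cong (degree n (matrix x)) i+1≡)))
  }
  where
  i+1≡ : i + 1 ≡ suc i
  i+1≡ = +-comm i 1
  i<n : suc i ≤ n
  i<n = subst (_≤ n) i+1≡ i+1≤n
  g = adjacentGen i 1≤i i<n
transposition-at-distance {n} (suc d) i 1≤i j≤n x arcs deg≡ = g ∷ w ++ g ∷ [] , record
  { positions = subst (λ t → ∀ a → toℕ (sourceW (g ∷ w ++ g ∷ []) a) ≡ swapℕ i t (toℕ a)) j≡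
                      (conjugate-positions (suc i + suc d) si<j w (Transposes.positions w-transposes))
  ; arcs-kept = conjugate-arcs x arcs w (Transposes.arcs-kept w-transposes)
  }
  where
  j≡ : suc i + suc d ≡ i + suc (suc d)
  j≡ = sym (+-suc i (suc d))
  j′≤n : suc i + suc d ≤ n
  j′≤n = subst (_≤ n) (sym j≡) j≤n
  i<n : suc i ≤ n
  i<n = ≤-trans (s≤s (m≤m+n i (suc d))) j′≤n
  si<j : suc (suc i) ≤ suc i + suc d
  si<j = s≤s (subst (_≤ i + suc d) (+-comm i 1) (+-monoʳ-≤ i (s≤s z≤n)))
  open Conjugation i 1≤i i<n
  recursive = transposition-at-distance d (suc i) (s≤s z≤n) j′≤n (act g x) (act-arcSystem x arcs)
                (act-degrees x arcs (suc i + suc d) si<j j′≤n (trans deg≡ (cong (degree n (matrix x)) (sym j≡))))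
  w = proj₁ recursive
  w-transposes = proj₂ recursive

module SwapFin {n} (p q : Fin (suc n)) (p≢q : toℕ p ≢ toℕ q) where

  swapFin : Fin (suc n) → Fin (suc n)
  swapFin a = clamp n (swapℕ (toℕ p) (toℕ q) (toℕ a))

  toℕ-swapFin : ∀ a → toℕ (swapFin a) ≡ swapℕ (toℕ p) (toℕ q) (toℕ a)
  toℕ-swapFin a = toℕ-clamp n _ (swapℕ-≤ (toℕ p) (toℕ q) (toℕ a) (Fin.toℕ≤pred[n] p) (Fin.toℕ≤pred[n] q) (Fin.toℕ≤pred[n] a))

  swapFin-fst : swapFin p ≡ q
  swapFin-fst = Fin.toℕ-injective (trans (toℕ-swapFin p) (swapℕ-fst (toℕ p) (toℕ q)))

  swapFin-snd : swapFin q ≡ p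
  swapFin-snd = Fin.toℕ-injective (trans (toℕ-swapFin q) (swapℕ-snd (toℕ p) (toℕ q) p≢q))

  swapFin-other : ∀ a → toℕ a ≢ toℕ p → toℕ a ≢ toℕ q → swapFin a ≡ a
  swapFin-other a a≢p a≢q = Fin.toℕ-injective (trans (toℕ-swapFin a) (swapℕ-other _ _ _ a≢p a≢q))

  swapFin-involutive : ∀ a → swapFin (swapFin a) ≡ a
  swapFin-involutive a = Fin.toℕ-injective
    (trans (toℕ-swapFin (swapFin a)) (trans (cong (swapℕ (toℕ p) (toℕ q)) (toℕ-swapFin a)) (swapℕ-involutive _ _ _ p≢q)))

swap-labels : ∀ {n} (y : Raw n) → ArcSystem n (matrix y) → (p q : Fin (suc n)) (1≤p : 1 ≤ toℕ p) (p<q : toℕ p < toℕ q) →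
              deg y p ≡ deg y q →
              Σ (List (Gen n)) λ w → actW w y ≈R raw⟨ lab y ∘ SwapFin.swapFin p q (<⇒≢ p<q) , mult y ⟩
swap-labels {n} y arcs p q 1≤p p<q deg≡ = w , same-labels , same-arcs
  where
  open SwapFin p q (<⇒≢ p<q)
  d = toℕ q ∸ suc (toℕ p)
  p+d≡q : toℕ p + suc d ≡ toℕ q
  p+d≡q = trans (+-suc (toℕ p) d) (m+[n∸m]≡n p<q)
  transposes = transposition-at-distance d (toℕ p) 1≤p (subst (_≤ n) (sym p+d≡q) (Fin.toℕ≤pred[n] q)) y arcs
    (trans (sym (deg≡degree y p)) (trans deg≡ (trans (deg≡degree y q) (cong (degree n (matrix y)) (sym p+d≡q)))))
  w = proj₁ transposes
  open Transposes (proj₂ transposes)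
  same-labels : ∀ a → lab (actW w y) a ≡ lab y (swapFin a)
  same-labels a = trans (lab-actW w y a) (cong (lab y) (trans (sym (clamp-toℕ n (sourceW w a)))
    (cong (clamp n) (trans (positions a) (cong (λ t → swapℕ (toℕ p) t (toℕ a)) p+d≡q)))))
  same-arcs : ∀ a b → mult (actW w y) a b ≡ mult y a b
  same-arcs a b = trans (cong₂ (mult (actW w y)) (sym (clamp-toℕ n a)) (sym (clamp-toℕ n b)))
    (trans (arcs-kept (toℕ a) (toℕ b) (Fin.toℕ≤pred[n] a) (Fin.toℕ≤pred[n] b))
           (cong₂ (mult y) (clamp-toℕ n a) (clamp-toℕ n b)))

-- Sorting the labels into their relabelled order

injective⇒surjective : ∀ {m} (f : Fin m → Fin m) → Injective _≡_ _≡_ f → ∀ c → Σ (Fin m) (λ a → f a ≡ c)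
injective⇒surjective {zero}  f f-inj ()
injective⇒surjective {suc m} f f-inj c with Fin.any? (λ a → f a Fin.≟ c)
... | yes hit  = hit
... | no  miss = ⊥-elim (<-irrefl refl (Fin.injective⇒≤ squeeze-injective))
  where
  c≢f : ∀ a → c ≢ f a
  c≢f a c≡fa = miss (a , sym c≡fa)
  squeeze : Fin (suc m) → Fin m
  squeeze a = punchOut (c≢f a)
  squeeze-injective : Injective _≡_ _≡_ squeeze
  squeeze-injective {a} {b} eq = f-inj (Fin.punchOut-injective (c≢f a) (c≢f b) eq)

liftσ-injective : ∀ {n} (σ : Permutation′ n) → Injective _≡_ _≡_ (liftσ σ)
liftσ-injective σ {zero}  {zero}  _  = refl
liftσ-injective σ {suc a} {suc b} eq =
  cong suc (trans (sym (inverseˡ σ)) (trans (cong (σ ⟨$⟩ˡ_) (Fin.suc-injective eq)) (inverseˡ σ)))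
liftσ-injective σ {zero}  {suc b} ()
liftσ-injective σ {suc a} {zero}  ()

lval-liftσ : ∀ {n} {l : Fin n → ℕ} {l∞} (σ : Permutation′ n) → (∀ k → l (σ ⟨$⟩ʳ k) ≡ l k) →
             ∀ c → lval l l∞ (liftσ σ c) ≡ lval l l∞ c
lval-liftσ σ σ-preserves zero    = refl
lval-liftσ σ σ-preserves (suc k) = σ-preserves k

deg-cong : ∀ {n} {x y : Raw n} → (∀ a b → mult x a b ≡ mult y a b) → ∀ a → deg x a ≡ deg y a
deg-cong mult≡ a = cong sum (List.tabulate-cong (mult≡ a))

module Relabelling {n} {l : Fin n → ℕ} {l∞ : ℕ} (x : Diagram n l l∞) (σ : Permutation′ n)
                   (σ-preserves : ∀ k → l (σ ⟨$⟩ʳ k) ≡ l k) where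

  X : Raw n
  X = raw x

  target : Pos n → Pos n
  target a = liftσ σ (lab X a)

  target-injective : Injective _≡_ _≡_ target
  target-injective eq = lab-inj x (liftσ-injective σ eq)

  target-valence : ∀ a → lval l l∞ (target a) ≡ deg X a
  target-valence a = trans (lval-liftσ σ σ-preserves (lab X a)) (sym (valence x a))

  target-∞ : target zero ≡ zero
  target-∞ rewrite lab-∞ x = refl

  record SortedBelow (y : Raw n) (m : ℕ) : Set where
    field
      arcs-unchanged   : ∀ a b → mult y a b ≡ mult X a b
      labels-injective : Injective _≡_ _≡_ (lab y)
      labels-valence   : ∀ a → lval l l∞ (lab y a) ≡ deg X a
      label-∞          : lab y zero ≡ zero
      labels-sorted    : ∀ a → toℕ a < m → lab y a ≡ target a
  open SortedBelow

  sortedBelow-suc : ∀ {y m} → SortedBelow y m → ∀ p → toℕ p ≡ m → lab y p ≡ target p → SortedBelow y (suc m)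
  sortedBelow-suc {y} {m} s p p≡m placed = record
    { arcs-unchanged = arcs-unchanged s ; labels-injective = labels-injective s
    ; labels-valence = labels-valence s ; label-∞ = label-∞ s
    ; labels-sorted = λ a a<1+m → below-or-at a (m≤n⇒m<n∨m≡n (≤-pred a<1+m))
    }
    where
    below-or-at : ∀ a → toℕ a < m ⊎ toℕ a ≡ m → lab y a ≡ target a
    below-or-at a (inj₁ a<m) = labels-sorted s a a<m
    below-or-at a (inj₂ a≡m) with Fin.toℕ-injective (trans a≡m (sym p≡m))
    ... | refl = placed

  swapped-sortedBelow : ∀ {y m} → SortedBelow y m → ∀ p q (p<q : toℕ p < toℕ q) → 1 ≤ toℕ p → m ≤ toℕ p →
                        deg X p ≡ deg X q → SortedBelow raw⟨ lab y ∘ SwapFin.swapFin p q (<⇒≢ p<q) , mult y ⟩ m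
  swapped-sortedBelow {y} {m} s p q p<q 1≤p m≤p deg≡ = record
    { arcs-unchanged   = arcs-unchanged s
    ; labels-injective = λ {a} {b} eq → trans (sym (swapFin-involutive a))
                           (trans (cong swapFin (labels-injective s eq)) (swapFin-involutive b))
    ; labels-valence   = λ a → trans (labels-valence s (swapFin a)) (deg-swapFin a)
    ; label-∞          = trans (cong (lab y) (swapFin-other zero (<⇒≢ 1≤p)
                                                             (<⇒≢ (<-trans 1≤p p<q)))) (label-∞ s)
    ; labels-sorted    = λ a a<m → trans (cong (lab y) (swapFin-other a (<⇒≢ (<-≤-trans a<m m≤p))
                                                            (<⇒≢ (<-trans (<-≤-trans a<m m≤p) p<q))))
                                        (labels-sorted s a a<m)
    }
    where
    open SwapFin p q (<⇒≢ p<q)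
    deg-swapFin : ∀ a → deg X (swapFin a) ≡ deg X a
    deg-swapFin a with toℕ a ≟ toℕ p | toℕ a ≟ toℕ q
    ... | yes a≡p | _ rewrite Fin.toℕ-injective a≡p = trans (cong (deg X) swapFin-fst) (sym deg≡)
    ... | no  _   | yes a≡q rewrite Fin.toℕ-injective a≡q = trans (cong (deg X) swapFin-snd) deg≡
    ... | no  a≢p | no  a≢q = cong (deg X) (swapFin-other a a≢p a≢q)

  sort-position : ∀ y m → m ≤ n → SortedBelow y m →
                  Σ (List (Gen n)) λ w → Σ (Raw n) λ y′ → actW w y ≈R y′ × SortedBelow y′ (suc m)
  sort-position y m m≤n s = place (lab y p Fin.≟ target p)
    where
    p = clamp n m
    p≡m : toℕ p ≡ m
    p≡m = toℕ-clamp n m m≤n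
    place : Dec (lab y p ≡ target p) → Σ (List (Gen n)) λ w → Σ (Raw n) λ y′ → actW w y ≈R y′ × SortedBelow y′ (suc m)
    place (yes placed)   = [] , y , ((λ _ → refl) , (λ _ _ → refl)) , sortedBelow-suc s p p≡m placed
    place (no misplaced) = proj₁ swapping , _ , proj₂ swapping ,
      sortedBelow-suc (swapped-sortedBelow s p q p<q 1≤p (≤-reflexive (sym p≡m)) deg≡) p p≡m
                      (trans (cong (lab y) (SwapFin.swapFin-fst p q (<⇒≢ p<q))) q↦p)
      where
      q = proj₁ (injective⇒surjective (lab y) (labels-injective s) (target p))
      q↦p : lab y q ≡ target p
      q↦p = proj₂ (injective⇒surjective (lab y) (labels-injective s) (target p))
      q≢p : q ≢ p
      q≢p q≡p = misplaced (trans (cong (lab y) (sym q≡p)) q↦p)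
      -- positions below p already carry their own targets, so q lies beyond p
      p<q : toℕ p < toℕ q
      p<q with m≤n⇒m<n∨m≡n (≮⇒≥ λ q<m → q≢p (target-injective (trans (sym (labels-sorted s q q<m)) q↦p)))
      ... | inj₁ m<q = subst (_< toℕ q) (sym p≡m) m<q
      ... | inj₂ m≡q = ⊥-elim (q≢p (Fin.toℕ-injective (trans (sym m≡q) (sym p≡m))))
      1≤p : 1 ≤ toℕ p
      1≤p with toℕ p in p≡0
      ... | suc _ = s≤s z≤n
      ... | zero  = ⊥-elim (misplaced (subst (λ a → lab y a ≡ target a) (sym (Fin.toℕ-injective p≡0))
                                             (trans (label-∞ s) (sym target-∞))))
      deg-y≡deg-X : ∀ a → deg y a ≡ deg X a
      deg-y≡deg-X = deg-cong {x = y} {y = X} (arcs-unchanged s)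
      deg≡ : deg X p ≡ deg X q
      deg≡ = trans (sym (target-valence p)) (trans (cong (lval l l∞) (sym q↦p)) (labels-valence s q))
      swapping : Σ (List (Gen n)) λ w → actW w y ≈R raw⟨ lab y ∘ SwapFin.swapFin p q (<⇒≢ p<q) , mult y ⟩
      swapping = swap-labels y (arcSystem-cong (λ a b _ _ → sym (arcs-unchanged s (clamp n a) (clamp n b))) (diagram-arcSystem x))
                   p q 1≤p p<q (trans (deg-y≡deg-X p) (trans deg≡ (sym (deg-y≡deg-X q))))

  sort-from : ∀ f m → m + f ≡ suc n → ∀ y → SortedBelow y m → Σ (List (Gen n)) λ w → actW w y ≈R relabel σ X
  sort-from zero m m≡ y s =
    [] , (λ a → labels-sorted s a (subst (toℕ a <_) (trans (sym m≡) (+-identityʳ m)) (Fin.toℕ<n a))) , arcs-unchanged s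
  sort-from (suc f) m m+f≡ y s with sort-position y m m≤n s
    where
    m≤n : m ≤ n
    m≤n = ≤-pred (subst (suc m ≤_) m+f≡ (subst (_≤ m + suc f) (+-comm m 1) (+-monoʳ-≤ m (s≤s z≤n))))
  ... | w , y′ , w·y≈y′ , s′ with sort-from f (suc m) (trans (sym (+-suc m f)) m+f≡) y′ s′
  ...   | w′ , w′·y′≈ = w′ ++ w , subst (_≈R relabel σ X) (sym (actW-++ w′ w y)) (≈R-trans (actW-cong w′ w·y≈y′) w′·y′≈)

  relabelling-reachable : ∃[ w ] (actW w X ≈R relabel σ X)
  relabelling-reachable = sort-from (suc n) 0 refl X record
    { arcs-unchanged = λ _ _ → refl ; labels-injective = lab-inj x ; labels-valence = sym ∘ valence x
    ; label-∞ = lab-∞ x ; labels-sorted = λ _ () }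

corollary3p3 : (n : ℕ) → 2 ≤ n → (l : Fin n → ℕ) (l∞ : ℕ) (x : Diagram n l l∞)
               (σ : Permutation′ n) → (∀ k → l (σ ⟨$⟩ʳ k) ≡ l k) →
               ∃[ w ] (actW {n} w (raw x) ≈R relabel σ (raw x))
corollary3p3 n _ l l∞ x σ σ-preserves = Relabelling.relabelling-reachable x σ σ-preserves
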